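{- For $n \geq 6$, consider partitions of $n$ with parts $q_1 \geq q_2 \geq \cdots \geq q_h$ such that $h \geq 3$, $q_j - q_{j+1} \in \{0,1\}$ for all $1 \leq j \leq h-1$, $q_1 = q_2$, and $q_{h-1} = q_h = 3$. Let $e''(n)$ (respectively $o''(n)$) be the number of such partitions of $n$ with an even (respectively odd) number $h$ of parts. Then for every $n \geq 6$: (a) $e''(n) = o''(n)$ whenever $n$ is not of any of the forms $\tfrac12(3t^2+t+4)$, $\tfrac12(3(t+1)^2-t-1)$, $\tfrac12(3(t+1)^2-t+3)$, $\tfrac12(3(t+1)^2+t+1)$ with $t$ an integer $\geq 2$; (b) $e''(n) = o''(n) - 1$ whenever $n = \tfrac12(3t^2+t+4)$ or $n = \tfrac12(3(t+1)^2+t+1)$ for some integer $t \geq 2$; (c) $e''(n) = o''(n) + 1$ whenever $n = \tfrac12(3(t+1)^2-t-1)$ or $n = \tfrac12(3(t+1)^2-t+3)$ for some integer $t \geq 2$. -}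

module Defs where

open import Data.Nat using (ℕ; zero; suc; _+_; _*_; _∸_; _^_; _≤_; _≤?_; _≟_)
open import Data.Nat.DivMod using (_%_)
open import Data.Nat.ListAction using (sum)
open import Data.List using (List; []; _∷_; length; map; concatMap; applyUpTo; reverse; filter)
open import Data.List.Relation.Unary.Linked using (Linked; linked?)
open import Data.Product using (_×_; _,_; ∃; ∃-syntax)
open import Data.Product.Properties using (≡-dec)
open import Data.Sum using (_⊎_; inj₁; inj₂)
open import Relation.Nullary using (Dec; yes; no; ¬_)
open import Relation.Nullary.Decidable using (_×-dec_; _⊎-dec_)
open import Relation.Binary.PropositionalEquality using (_≡_; refl)

Step : ℕ → ℕ → Set
Step x y = x ≡ y ⊎ x ≡ suc y

step? : (x y : ℕ) → Dec (Step x y)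
step? x y = (x ≟ y) ⊎-dec (x ≟ suc y)

FirstTwoEqual : List ℕ → Set
FirstTwoEqual q = ∃[ x ] ∃[ r ] q ≡ x ∷ x ∷ r

firstTwoEqual? : (q : List ℕ) → Dec (FirstTwoEqual q)
firstTwoEqual? [] = no λ { (_ , _ , ()) }
firstTwoEqual? (x ∷ []) = no λ { (_ , _ , ()) }
firstTwoEqual? (x ∷ y ∷ r) with x ≟ y
... | yes refl = yes (x , r , refl)
... | no x≢y = no λ { (_ , _ , refl) → x≢y refl }

LastTwoThree : List ℕ → Set
LastTwoThree q = ∃[ r ] reverse q ≡ 3 ∷ 3 ∷ r

lastTwoThree? : (q : List ℕ) → Dec (LastTwoThree q)
lastTwoThree? q = go (reverse q)
  where
  go : (l : List ℕ) → Dec (∃[ r ] l ≡ 3 ∷ 3 ∷ r)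
  go [] = no λ { (_ , ()) }
  go (x ∷ []) = no λ { (_ , ()) }
  go (x ∷ y ∷ r) with x ≟ 3 | y ≟ 3
  ... | yes refl | yes refl = yes (r , refl)
  ... | no x≢3 | _ = no λ { (_ , refl) → x≢3 refl }
  ... | yes _ | no y≢3 = no λ { (_ , refl) → y≢3 refl }

-- A list q = (q₁, …, q_h) of positive parts is one of the partitions of n
-- counted in Corollary 4.10.  (Non-increasing is implied by Step.)
Counted : ℕ → List ℕ → Set
Counted n q = (sum q ≡ n) × (3 ≤ length q) × Linked Step q
              × FirstTwoEqual q × LastTwoThree q

counted? : (n : ℕ) (q : List ℕ) → Dec (Counted n q)
counted? n q = (sum q ≟ n) ×-dec ((3 ≤? length q) ×-dec (linked? step? q
               ×-dec (firstTwoEqual? q ×-dec lastTwoThree? q)))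

listsOfLength : ℕ → ℕ → List (List ℕ)
listsOfLength zero m = [] ∷ []
listsOfLength (suc k) m =
  concatMap (λ x → map (x ∷_) (listsOfLength k m)) (applyUpTo suc m)

-- all lists of length ≤ n with entries in {1,…,n}, without repetition;
-- every partition of n (positive parts, in order) occurs exactly once here
candidates : ℕ → List (List ℕ)
candidates n = concatMap (λ k → listsOfLength k n) (applyUpTo (λ i → i) (suc n))

e'' : ℕ → ℕ
e'' n = length (filter (λ q → counted? n q ×-dec (length q % 2 ≟ 0)) (candidates n))

o'' : ℕ → ℕ
o'' n = length (filter (λ q → counted? n q ×-dec (length q % 2 ≟ 1)) (candidates n))

FormA FormB FormC FormD : ℕ → Set
FormA n = ∃[ t ] 2 ≤ t × 2 * n ≡ 3 * t ^ 2 + t + 4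
FormB n = ∃[ t ] 2 ≤ t × 2 * n ≡ 3 * (t + 1) ^ 2 ∸ t ∸ 1
FormC n = ∃[ t ] 2 ≤ t × 2 * n ≡ 3 * (t + 1) ^ 2 ∸ t + 3
FormD n = ∃[ t ] 2 ≤ t × 2 * n ≡ 3 * (t + 1) ^ 2 + t + 1

-- A counted partition of length h is determined by the positions d at which it
-- drops (q_d = q_{d+1} + 1); they satisfy 2 ≤ d ≤ h − 2, and the partition has
-- weight 3h + Σ d. Keeping the drop at 2 aside, the other drop positions E carry
-- a Franklin-type involution: remove the smallest position if it is 3 (h grows
-- by one), or else append 3 when there is room (h shrinks by one), except that
-- when the largest position is h − 2 it is set aside and the same rule is applied
-- one level in, with 4 in place of 3. This preserves 3h + Σ E and flips the
-- parity of h, so it pairs partitions with an even and an odd number of parts.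
-- The fixed points are E = h−2, h−3, …, ⌈h/2⌉+1, at most one for each n, and
-- their weights are exactly the exceptional forms: A and D for odd h, B and C for
-- even h.

module Submission where

open import Defs
open import Data.Nat using (ℕ; zero; suc; pred; _+_; _*_; _∸_; _^_; _≤_; _<_; _>_; z≤n; s≤s; _≤?_; _≟_)
open import Data.Nat.Properties
open import Data.Nat.DivMod using (_%_; [m+kn]%n≡m%n; m*n%n≡0; m%n<n)
open import Data.Nat.ListAction using (sum)
open import Data.Nat.ListAction.Properties using (sum-++)
open import Data.Nat.Tactic.RingSolver using (solve-∀)
open import Data.Bool using (Bool; true; false)
open import Data.List using (List; []; _∷_; _++_; [_]; _∷ʳ_; map; length; replicate; reverse; takeWhile; filter; concatMap; applyUpTo)
open import Data.List.Properties
  using (length-++; length-map; length-replicate; ++-assoc; ++-identityʳ; reverse-++; reverse-involutive; filter-none; ∷-injectiveˡ; ∷-injectiveʳ)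
open import Data.List.Relation.Unary.All using (All; []; _∷_)
import Data.List.Relation.Unary.All as All
import Data.List.Relation.Unary.All.Properties as Allₚ
open import Data.List.Relation.Unary.Any using (here; there)
import Data.List.Relation.Unary.Any as Any
import Data.List.Relation.Unary.AllPairs as AllPairs
import Data.List.Relation.Unary.AllPairs.Properties as AllPairsₚ
open import Data.List.Relation.Unary.Linked using (Linked; []; [-]; _∷_)
import Data.List.Relation.Unary.Linked as Linked
open import Data.List.Relation.Unary.Linked.Properties using (Linked⇒All)
open import Data.List.Relation.Unary.Unique.Propositional using (Unique; []; _∷_)
import Data.List.Relation.Unary.Unique.Propositional.Properties as Unique
open import Data.List.Relation.Binary.Disjoint.Propositional using (Disjoint)
open import Data.List.Relation.Binary.Subset.Propositional using (_⊆_)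
open import Data.List.Membership.Propositional using (_∈_)
open import Data.List.Membership.Propositional.Properties
  using (∈-∃++; ∈-++⁻; ∈-++⁺ˡ; ∈-++⁺ʳ; ∈-filter⁻; ∈-filter⁺; ∈-map⁺; ∈-map⁻
        ; ∈-concatMap⁺; ∈-concatMap⁻; ∈-applyUpTo⁺)
open import Data.Maybe using (Maybe; just; nothing; fromMaybe)
import Data.Maybe as Maybe
open import Data.Product using (_×_; _,_; proj₁; proj₂; ∃-syntax)
open import Data.Sum using (_⊎_; inj₁; inj₂)
open import Data.Empty using (⊥-elim)
open import Level using (0ℓ)
open import Relation.Nullary using (¬_; Dec; yes; no; does)
open import Relation.Nullary.Decidable using (_×-dec_; ¬?)
open import Relation.Unary using (Pred; Decidable)
open import Relation.Binary.Definitions using (tri<; tri≈; tri>)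
open import Relation.Binary.PropositionalEquality using (_≡_; _≢_; refl; sym; trans; cong; cong₂; subst; subst₂; module ≡-Reasoning)

module _ {A : Set} where

  unique-⊆⇒length-≤ : {xs ys : List A} → Unique xs → xs ⊆ ys → length xs ≤ length ys
  unique-⊆⇒length-≤ {[]} _ _ = z≤n
  unique-⊆⇒length-≤ {x ∷ xs} (x∉xs ∷ u) xs⊆ys with ∈-∃++ (xs⊆ys (here refl))
  ... | us , vs , refl = ≤-trans (s≤s (unique-⊆⇒length-≤ u xs⊆us++vs)) (≤-reflexive length-us++x∷vs)
    where
    xs⊆us++vs : xs ⊆ us ++ vs
    xs⊆us++vs {z} z∈xs with ∈-++⁻ us (xs⊆ys (there z∈xs))
    ... | inj₁ z∈us = ∈-++⁺ˡ z∈us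
    ... | inj₂ (here refl) = ⊥-elim (All.lookup x∉xs z∈xs refl)
    ... | inj₂ (there z∈vs) = ∈-++⁺ʳ us z∈vs
    length-us++x∷vs : suc (length (us ++ vs)) ≡ length (us ++ x ∷ vs)
    length-us++x∷vs = begin
      suc (length (us ++ vs))         ≡⟨ cong suc (length-++ us) ⟩
      suc (length us + length vs)     ≡⟨ +-suc (length us) (length vs) ⟨
      length us + length (x ∷ vs)     ≡⟨ length-++ us ⟨
      length (us ++ x ∷ vs)           ∎
      where open ≡-Reasoning

  map⁺-injectiveOn : {B : Set} (f : A → B) {xs : List A} → Unique xs →
                     (∀ {x y} → x ∈ xs → y ∈ xs → f x ≡ f y → x ≡ y) → Unique (map f xs)
  map⁺-injectiveOn f {[]} [] _ = []
  map⁺-injectiveOn f {x ∷ xs} (x∉xs ∷ u) inj =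
    Allₚ.map⁺ (All.tabulate λ y∈xs fx≡fy → All.lookup x∉xs y∈xs (inj (here refl) (there y∈xs) fx≡fy))
    ∷ map⁺-injectiveOn f u (λ x∈ y∈ → inj (there x∈) (there y∈))

  length-filter-≤ : {P Q : Pred A 0ℓ} (P? : Decidable P) (Q? : Decidable Q) {L : List A} → Unique L →
                    (f : A → A) → (∀ {x} → x ∈ L → P x → f x ∈ L × Q (f x) × f (f x) ≡ x) →
                    length (filter P? L) ≤ length (filter Q? L)
  length-filter-≤ P? Q? {L} uL f f-maps = begin
    length (filter P? L)          ≡⟨ length-map f (filter P? L) ⟨
    length (map f (filter P? L))  ≤⟨ unique-⊆⇒length-≤ (map⁺-injectiveOn f (Unique.filter⁺ P? uL) f-injective) image⊆ ⟩
    length (filter Q? L)          ∎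
    where
    open Data.Nat.Properties.≤-Reasoning
    f-involutive : ∀ {x} → x ∈ filter P? L → f (f x) ≡ x
    f-involutive x∈ with ∈-filter⁻ P? x∈
    ... | x∈L , Px with f-maps x∈L Px
    ... | _ , _ , ffx≡x = ffx≡x
    f-injective : ∀ {x y} → x ∈ filter P? L → y ∈ filter P? L → f x ≡ f y → x ≡ y
    f-injective x∈ y∈ fx≡fy = trans (sym (f-involutive x∈)) (trans (cong f fx≡fy) (f-involutive y∈))
    image⊆ : map f (filter P? L) ⊆ filter Q? L
    image⊆ z∈ with ∈-map⁻ f z∈
    ... | x , x∈ , refl with ∈-filter⁻ P? x∈
    ... | x∈L , Px with f-maps x∈L Px
    ... | fx∈L , Qfx , _ = ∈-filter⁺ Q? fx∈L Qfx

  length-filter-≡ : {P Q : Pred A 0ℓ} (P? : Decidable P) (Q? : Decidable Q) {L : List A} → Unique L →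
                    (f : A → A) →
                    (∀ {x} → x ∈ L → P x → f x ∈ L × Q (f x) × f (f x) ≡ x) →
                    (∀ {x} → x ∈ L → Q x → f x ∈ L × P (f x) × f (f x) ≡ x) →
                    length (filter P? L) ≡ length (filter Q? L)
  length-filter-≡ P? Q? uL f P→Q Q→P =
    ≤-antisym (length-filter-≤ P? Q? uL f P→Q) (length-filter-≤ Q? P? uL f Q→P)

  length-filter-split : {P Q : Pred A 0ℓ} (P? : Decidable P) (Q? : Decidable Q) (xs : List A) →
                        length (filter P? xs) ≡
                        length (filter (λ x → P? x ×-dec ¬? (Q? x)) xs) + length (filter (λ x → P? x ×-dec Q? x) xs)
  length-filter-split P? Q? [] = refl
  length-filter-split P? Q? (x ∷ xs) with P? x | Q? x
  ... | yes _ | yes _ = trans (cong suc (length-filter-split P? Q? xs)) (sym (+-suc _ _))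
  ... | yes _ | no _ = cong suc (length-filter-split P? Q? xs)
  ... | no _  | _ = length-filter-split P? Q? xs

  length-filter-≡0 : {P : Pred A 0ℓ} (P? : Decidable P) (xs : List A) → (∀ {x} → x ∈ xs → ¬ P x) →
                     length (filter P? xs) ≡ 0
  length-filter-≡0 P? xs none = cong length (filter-none P? (All.tabulate none))

  length-filter-≡1 : {P : Pred A 0ℓ} (P? : Decidable P) {xs : List A} → Unique xs → {a : A} → a ∈ xs → P a →
                     (∀ {x} → x ∈ xs → P x → x ≡ a) → length (filter P? xs) ≡ 1
  length-filter-≡1 P? {x ∷ xs} (x∉xs ∷ _) (here refl) Pa only with P? x
  ... | yes _ = cong suc (length-filter-≡0 P? xs λ y∈xs Py → All.lookup x∉xs y∈xs (sym (only (there y∈xs) Py)))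
  ... | no ¬Pa = ⊥-elim (¬Pa Pa)
  length-filter-≡1 P? {x ∷ xs} (x∉xs ∷ u) (there a∈xs) Pa only with P? x
  ... | yes Px = ⊥-elim (All.lookup x∉xs a∈xs (only (here refl) Px))
  ... | no _ = length-filter-≡1 P? u a∈xs Pa (λ y∈xs → only (there y∈xs))

concatMap-unique : {A B : Set} (f : A → List B) {xs : List A} → Unique xs → All (λ x → Unique (f x)) xs →
                   (∀ {x y} → x ≢ y → Disjoint (f x) (f y)) → Unique (concatMap f xs)
concatMap-unique f uxs ufs disjoint =
  Unique.concat⁺ (Allₚ.map⁺ ufs) (AllPairsₚ.map⁺ (AllPairs.map disjoint uxs))

applyUpTo-suc-unique : ∀ m → Unique (applyUpTo suc m)
applyUpTo-suc-unique m = Unique.applyUpTo⁺₁ suc m (λ i<j _ 1+i≡1+j → <⇒≢ i<j (suc-injective 1+i≡1+j))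

listsOfLength-length : ∀ k m {q} → q ∈ listsOfLength k m → length q ≡ k
listsOfLength-length zero m (here refl) = refl
listsOfLength-length (suc k) m q∈ with Any.satisfied (∈-concatMap⁻ _ {xs = applyUpTo suc m} q∈)
... | x , q∈x∷ with ∈-map⁻ (x ∷_) q∈x∷
... | r , r∈ , refl = cong suc (listsOfLength-length k m r∈)

listsOfLength-unique : ∀ k m → Unique (listsOfLength k m)
listsOfLength-unique zero m = [] ∷ []
listsOfLength-unique (suc k) m =
  concatMap-unique _ (applyUpTo-suc-unique m)
    (All.tabulate λ _ → Unique.map⁺ ∷-injectiveʳ (listsOfLength-unique k m))
    heads-disjoint
  where
  heads-disjoint : ∀ {x y} → x ≢ y → Disjoint (map (x ∷_) (listsOfLength k m)) (map (y ∷_) (listsOfLength k m))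
  heads-disjoint x≢y (q∈x∷ , q∈y∷) with ∈-map⁻ _ q∈x∷ | ∈-map⁻ _ q∈y∷
  ... | _ , _ , refl | _ , _ , x∷r≡y∷s = x≢y (∷-injectiveˡ x∷r≡y∷s)

candidates-unique : ∀ n → Unique (candidates n)
candidates-unique n =
  concatMap-unique _ (Unique.applyUpTo⁺₁ _ (suc n) (λ i<j _ → <⇒≢ i<j))
    (All.tabulate λ {k} _ → listsOfLength-unique k n)
    λ k≢l (q∈k , q∈l) → k≢l (trans (sym (listsOfLength-length _ n q∈k)) (listsOfLength-length _ n q∈l))

∈-listsOfLength : ∀ m q → All (λ x → 1 ≤ x × x ≤ m) q → q ∈ listsOfLength (length q) m
∈-listsOfLength m [] [] = here refl
∈-listsOfLength m (suc x ∷ q) ((_ , x<m) ∷ bounds) =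
  ∈-concatMap⁺ _ {xs = applyUpTo suc m} (Any.map (λ { refl → ∈-map⁺ _ (∈-listsOfLength m q bounds) }) (∈-applyUpTo⁺ suc x<m))

∈-candidates : ∀ n q → All (λ x → 1 ≤ x × x ≤ n) q → length q ≤ n → q ∈ candidates n
∈-candidates n q bounds len≤n =
  ∈-concatMap⁺ (λ k → listsOfLength k n) {xs = applyUpTo (λ i → i) (suc n)}
    (Any.map (λ { refl → ∈-listsOfLength n q bounds }) (∈-applyUpTo⁺ (λ i → i) (s≤s len≤n)))

-- Partitions as sets of drop positions

Decreasing : List ℕ → Set
Decreasing = Linked _>_

-- The j-th part of fromSteps h D is 3 + #{d ∈ D | j ≤ d}.
fromSteps : ℕ → List ℕ → List ℕ
fromSteps h [] = replicate h 3
fromSteps h (d ∷ D) = map suc (fromSteps d D) ++ replicate (h ∸ d) 3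

StepSet : ℕ → List ℕ → Set
StepSet h D = Decreasing D × All (λ d → 1 ≤ d × d < h) D

decreasing-head : ∀ {d D} → Decreasing (d ∷ D) → All (_< d) D
decreasing-head [-] = []
decreasing-head (d>e ∷ rest) = Linked⇒All (λ x>y y>z → <-trans y>z x>y) d>e rest

decreasing-∷ : ∀ {d D} → Decreasing D → All (_< d) D → Decreasing (d ∷ D)
decreasing-∷ [] _ = [-]
decreasing-∷ [-] (e<d ∷ _) = e<d ∷ [-]
decreasing-∷ (e>f ∷ dec) (e<d ∷ _) = e<d ∷ e>f ∷ dec

stepSet-tail : ∀ {h d D} → StepSet h (d ∷ D) → StepSet d D
stepSet-tail (dec , _ ∷ bounds) =
  Linked.tail dec , All.zipWith (λ ((1≤e , _) , e<d) → 1≤e , e<d) (bounds , decreasing-head dec)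

length-fromSteps : ∀ h D → StepSet h D → length (fromSteps h D) ≡ h
length-fromSteps h [] _ = length-replicate h
length-fromSteps h (d ∷ D) S@(_ , (_ , d<h) ∷ _) = begin
  length (map suc (fromSteps d D) ++ replicate (h ∸ d) 3)  ≡⟨ length-++ (map suc (fromSteps d D)) ⟩
  length (map suc (fromSteps d D)) + length (replicate (h ∸ d) 3)
    ≡⟨ cong₂ _+_ (trans (length-map suc (fromSteps d D)) (length-fromSteps d D (stepSet-tail S))) (length-replicate (h ∸ d)) ⟩
  d + (h ∸ d)                                                ≡⟨ m+[n∸m]≡n (<⇒≤ d<h) ⟩
  h                                                          ∎
  where open ≡-Reasoning

sum-replicate-3 : ∀ k → sum (replicate k 3) ≡ 3 * k
sum-replicate-3 zero = refl
sum-replicate-3 (suc k) = trans (cong (3 +_) (sum-replicate-3 k)) (sym (*-suc 3 k))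

sum-map-suc : ∀ xs → sum (map suc xs) ≡ sum xs + length xs
sum-map-suc [] = refl
sum-map-suc (x ∷ xs) = trans (cong (suc x +_) (sum-map-suc xs)) (regroup x (sum xs) (length xs))
  where
  regroup : ∀ x s l → suc x + (s + l) ≡ x + s + suc l
  regroup = solve-∀

sum-fromSteps : ∀ h D → StepSet h D → sum (fromSteps h D) ≡ 3 * h + sum D
sum-fromSteps h [] _ = trans (sum-replicate-3 h) (sym (+-identityʳ (3 * h)))
sum-fromSteps h (d ∷ D) S@(_ , (_ , d<h) ∷ _) with m≤n⇒∃[o]m+o≡n (<⇒≤ d<h)
... | k , refl = begin
  sum (map suc (fromSteps d D) ++ replicate (d + k ∸ d) 3)
    ≡⟨ sum-++ (map suc (fromSteps d D)) _ ⟩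
  sum (map suc (fromSteps d D)) + sum (replicate (d + k ∸ d) 3)
    ≡⟨ cong₂ _+_ (sum-map-suc (fromSteps d D)) (trans (cong (λ m → sum (replicate m 3)) (m+n∸m≡n d k)) (sum-replicate-3 k)) ⟩
  sum (fromSteps d D) + length (fromSteps d D) + 3 * k
    ≡⟨ cong₂ (λ s l → s + l + 3 * k) (sum-fromSteps d D (stepSet-tail S)) (length-fromSteps d D (stepSet-tail S)) ⟩
  3 * d + sum D + d + 3 * k
    ≡⟨ regroup d k (sum D) ⟩
  3 * (d + k) + (d + sum D)  ∎
  where
  open ≡-Reasoning
  regroup : ∀ d k s → 3 * d + s + d + 3 * k ≡ 3 * (d + k) + (d + s)
  regroup = solve-∀

∸-suc-∸ : ∀ {d h} → d < h → h ∸ d ≡ suc (h ∸ suc d)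
∸-suc-∸ {zero} {suc h} _ = refl
∸-suc-∸ {suc d} {suc h} (s≤s d<h) = ∸-suc-∸ d<h

data Ramp : List ℕ → Set where
  [3] : Ramp [ 3 ]
  _∷_ : ∀ {x y r} → Step x y → Ramp (y ∷ r) → Ramp (x ∷ y ∷ r)

ramp-linked : ∀ {q} → Ramp q → Linked Step q
ramp-linked [3] = [-]
ramp-linked (xy ∷ ramp) = xy ∷ ramp-linked ramp

ramp-replicate : ∀ k → Ramp (replicate (suc k) 3)
ramp-replicate zero = [3]
ramp-replicate (suc k) = inj₁ refl ∷ ramp-replicate k

ramp-raise : ∀ {p} k → Ramp p → Ramp (map suc p ++ replicate (suc k) 3)
ramp-raise k [3] = inj₂ refl ∷ ramp-replicate k
ramp-raise k (inj₁ refl ∷ ramp) = inj₁ refl ∷ ramp-raise k ramp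
ramp-raise k (inj₂ refl ∷ ramp) = inj₂ refl ∷ ramp-raise k ramp

ramp-fromSteps : ∀ {h D} → StepSet h D → 1 ≤ h → Ramp (fromSteps h D)
ramp-fromSteps {suc h} {[]} _ _ = ramp-replicate h
ramp-fromSteps {h} {d ∷ D} S@(_ , (1≤d , d<h) ∷ _) _ rewrite ∸-suc-∸ d<h =
  ramp-raise (h ∸ suc d) (ramp-fromSteps (stepSet-tail S) 1≤d)

ramp-≥3 : ∀ {q} → Ramp q → All (3 ≤_) q
ramp-≥3 [3] = ≤-refl ∷ []
ramp-≥3 (inj₁ refl ∷ ramp) with ramp-≥3 ramp
... | 3≤y ∷ rest = 3≤y ∷ 3≤y ∷ rest
ramp-≥3 (inj₂ refl ∷ ramp) with ramp-≥3 ramp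
... | 3≤y ∷ rest = m≤n⇒m≤1+n 3≤y ∷ 3≤y ∷ rest

fromSteps-firstTwoEqual : ∀ {h D} → StepSet h D → All (2 ≤_) D → 2 ≤ h → FirstTwoEqual (fromSteps h D)
fromSteps-firstTwoEqual {suc (suc k)} {[]} _ _ _ = 3 , replicate k 3 , refl
fromSteps-firstTwoEqual {1} {[]} _ _ (s≤s ())
fromSteps-firstTwoEqual {h} {d ∷ D} S (2≤d ∷ 2≤D) _ with fromSteps-firstTwoEqual (stepSet-tail S) 2≤D 2≤d
... | x , r , eq = suc x , map suc r ++ replicate (h ∸ d) 3 , cong (λ q → map suc q ++ replicate (h ∸ d) 3) eq

lastTwoThree-++ : ∀ s → LastTwoThree (s ++ 3 ∷ 3 ∷ [])
lastTwoThree-++ s = reverse s , reverse-++ s (3 ∷ 3 ∷ [])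

replicate-ends33 : ∀ {m} → 2 ≤ m → replicate m 3 ≡ replicate (m ∸ 2) 3 ++ 3 ∷ 3 ∷ []
replicate-ends33 {2} _ = refl
replicate-ends33 {1} (s≤s ())
replicate-ends33 {suc (suc (suc k))} _ = cong (3 ∷_) (replicate-ends33 {suc (suc k)} (s≤s (s≤s z≤n)))

fromSteps-lastTwoThree : ∀ h D → All (λ d → d + 2 ≤ h) D → 2 ≤ h → LastTwoThree (fromSteps h D)
fromSteps-lastTwoThree h [] _ 2≤h = subst LastTwoThree (sym (replicate-ends33 2≤h)) (lastTwoThree-++ (replicate (h ∸ 2) 3))
fromSteps-lastTwoThree h (d ∷ D) (d+2≤h ∷ _) _ = subst LastTwoThree (sym ends33) (lastTwoThree-++ (p ++ replicate (h ∸ d ∸ 2) 3))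
  where
  p : List ℕ
  p = map suc (fromSteps d D)
  ends33 : p ++ replicate (h ∸ d) 3 ≡ (p ++ replicate (h ∸ d ∸ 2) 3) ++ 3 ∷ 3 ∷ []
  ends33 = trans (cong (p ++_) (replicate-ends33 (m+n≤o⇒m≤o∸n 2 (subst (_≤ h) (+-comm d 2) d+2≤h))))
                 (sym (++-assoc p (replicate (h ∸ d ∸ 2) 3) (3 ∷ 3 ∷ [])))

InteriorSteps : ℕ → List ℕ → Set
InteriorSteps h D = Decreasing D × All (λ d → 2 ≤ d × d + 2 ≤ h) D

interiorSteps⇒stepSet : ∀ {h D} → InteriorSteps h D → StepSet h D
interiorSteps⇒stepSet (dec , bounds) =
  dec , All.map (λ (2≤d , d+2≤h) → ≤-trans (s≤s z≤n) 2≤d , <-≤-trans (m<m+n _ (s≤s z≤n)) d+2≤h) bounds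

fromSteps-counted : ∀ {h D} → 3 ≤ h → InteriorSteps h D → Counted (3 * h + sum D) (fromSteps h D)
fromSteps-counted {h} {D} 3≤h I@(_ , bounds) =
  sum-fromSteps h D S ,
  subst (3 ≤_) (sym (length-fromSteps h D S)) 3≤h ,
  ramp-linked (ramp-fromSteps S (≤-trans (s≤s z≤n) 3≤h)) ,
  fromSteps-firstTwoEqual S (All.map proj₁ bounds) 2≤h ,
  fromSteps-lastTwoThree h D (All.map proj₂ bounds) 2≤h
  where
  S : StepSet h D
  S = interiorSteps⇒stepSet I
  2≤h : 2 ≤ h
  2≤h = ≤-trans (s≤s (s≤s z≤n)) 3≤h

data RampView (q : List ℕ) : Set where
  flat   : ∀ k → q ≡ replicate (suc k) 3 → RampView q
  raised : ∀ {p} k → Ramp p → q ≡ map suc p ++ replicate (suc k) 3 → RampView q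

rampView : ∀ {q} → Ramp q → RampView q
rampView [3] = flat 0 refl
rampView (_ ∷ ramp) with rampView ramp
rampView (inj₁ refl ∷ ramp) | flat k refl = flat (suc k) refl
rampView (inj₂ refl ∷ ramp) | flat k refl = raised k [3] refl
rampView (inj₁ refl ∷ ramp) | raised {_ ∷ _} k ramp′ refl = raised k (inj₁ refl ∷ ramp′) refl
rampView (inj₂ refl ∷ ramp) | raised {_ ∷ _} k ramp′ refl = raised k (inj₂ refl ∷ ramp′) refl

large : List ℕ → List ℕ
large = takeWhile (4 ≤?_)

large-replicate-3 : ∀ k → large (replicate k 3) ≡ []
large-replicate-3 zero = refl
large-replicate-3 (suc k) = refl

large-raised : ∀ {p} k → All (3 ≤_) p → large (map suc p ++ replicate k 3) ≡ map suc p
large-raised k [] = large-replicate-3 k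
large-raised k (s≤s (s≤s (s≤s z≤n)) ∷ 3≤p) = cong (_ ∷_) (large-raised k 3≤p)

length-large-before-3 : ∀ s t → length (large (s ++ 3 ∷ t)) ≤ length s
length-large-before-3 [] t = z≤n
length-large-before-3 (x ∷ s) t with does (4 ≤? x)
... | true = s≤s (length-large-before-3 s t)
... | false = z≤n

-- The first argument is fuel; any value ≥ length q suffices.
mutual
  toSteps : ℕ → List ℕ → List ℕ
  toSteps zero _ = []
  toSteps (suc f) q = stepsOfLarge f (large q)

  stepsOfLarge : ℕ → List ℕ → List ℕ
  stepsOfLarge f [] = []
  stepsOfLarge f p@(_ ∷ _) = length p ∷ toSteps f (map pred p)

map-pred-suc : ∀ xs → map pred (map suc xs) ≡ xs
map-pred-suc [] = refl
map-pred-suc (x ∷ xs) = cong (x ∷_) (map-pred-suc xs)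

stepsOfLarge-map-suc : ∀ f {p} → Ramp p → stepsOfLarge f (map suc p) ≡ length p ∷ toSteps f p
stepsOfLarge-map-suc f {x ∷ p} _ =
  cong₂ _∷_ (length-map suc (x ∷ p)) (cong (toSteps f) (map-pred-suc (x ∷ p)))

toSteps-flat : ∀ f k → toSteps f (replicate k 3) ≡ []
toSteps-flat zero k = refl
toSteps-flat (suc f) k = cong (stepsOfLarge f) (large-replicate-3 k)

toSteps-raised : ∀ f {p} k → Ramp p → toSteps (suc f) (map suc p ++ replicate k 3) ≡ length p ∷ toSteps f p
toSteps-raised f k ramp = trans (cong (stepsOfLarge f) (large-raised k (ramp-≥3 ramp))) (stepsOfLarge-map-suc f ramp)

ramp-nonempty : ∀ {q} → Ramp q → 1 ≤ length q
ramp-nonempty [3] = s≤s z≤n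
ramp-nonempty (_ ∷ _) = s≤s z≤n

length-map-suc-++ : ∀ p k → length (map suc p ++ replicate k 3) ≡ length p + k
length-map-suc-++ p k = trans (length-++ (map suc p)) (cong₂ _+_ (length-map suc p) (length-replicate k))

fromSteps-toSteps : ∀ f {q} → Ramp q → length q ≤ f → fromSteps (length q) (toSteps f q) ≡ q
fromSteps-toSteps zero ramp q≤0 = ⊥-elim (n≮0 (≤-trans (ramp-nonempty ramp) q≤0))
fromSteps-toSteps (suc f) ramp q≤f with rampView ramp
... | flat k refl = cong₂ (λ m D → fromSteps m D) (length-replicate (suc k)) (toSteps-flat (suc f) (suc k))
... | raised {p} k rampₚ refl = begin
  fromSteps L (toSteps (suc f) (map suc p ++ threes))
    ≡⟨ cong (fromSteps L) (toSteps-raised f (suc k) rampₚ) ⟩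
  map suc (fromSteps (length p) (toSteps f p)) ++ replicate (L ∸ length p) 3
    ≡⟨ cong₂ (λ P m → map suc P ++ replicate m 3) (fromSteps-toSteps f rampₚ p≤f) L∸p≡1+k ⟩
  map suc p ++ threes ∎
  where
  open ≡-Reasoning
  threes : List ℕ
  threes = replicate (suc k) 3
  L : ℕ
  L = length (map suc p ++ threes)
  L≡p+1+k : L ≡ length p + suc k
  L≡p+1+k = length-map-suc-++ p (suc k)
  L∸p≡1+k : L ∸ length p ≡ suc k
  L∸p≡1+k = trans (cong (_∸ length p) L≡p+1+k) (m+n∸m≡n (length p) (suc k))
  p≤f : length p ≤ f
  p≤f = ≤-pred (<-≤-trans (m<m+n (length p) (s≤s z≤n)) (subst (_≤ suc f) L≡p+1+k q≤f))

toSteps-fromSteps : ∀ f {h D} → StepSet h D → h ≤ f → toSteps f (fromSteps h D) ≡ D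
toSteps-fromSteps f {h} {[]} _ _ = toSteps-flat f h
toSteps-fromSteps zero {D = d ∷ D} (_ , (_ , d<h) ∷ _) h≤0 = ⊥-elim (n≮0 (<-≤-trans d<h h≤0))
toSteps-fromSteps (suc f) {h} {d ∷ D} S@(_ , (1≤d , d<h) ∷ _) h≤f =
  trans (toSteps-raised f (h ∸ d) (ramp-fromSteps Sₜ 1≤d))
        (cong₂ _∷_ (length-fromSteps d D Sₜ) (toSteps-fromSteps f Sₜ (≤-pred (<-≤-trans d<h h≤f))))
  where
  Sₜ : StepSet d D
  Sₜ = stepSet-tail S

ramp-length-large : ∀ {q} → Ramp q → length (large q) < length q
ramp-length-large ramp with rampView ramp
... | flat k refl = s≤s z≤n
... | raised {p} k rampₚ refl
  rewrite large-raised (suc k) (ramp-≥3 rampₚ) | length-map-suc-++ p (suc k) | length-map suc p =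
  m<m+n (length p) (s≤s z≤n)

toSteps-stepSet : ∀ f {q} → Ramp q → StepSet (suc (length (large q))) (toSteps f q)
toSteps-stepSet zero _ = [] , []
toSteps-stepSet (suc f) ramp with rampView ramp
... | flat k refl = subst (StepSet _) (sym (toSteps-flat (suc f) (suc k))) ([] , [])
... | raised {p} k rampₚ refl
  rewrite large-raised (suc k) (ramp-≥3 rampₚ) | stepsOfLarge-map-suc f rampₚ | length-map suc p =
  decreasing-∷ decₜ (All.map (λ (_ , d≤ℓ) → below-p d≤ℓ) boundsₜ) ,
  (ramp-nonempty rampₚ , ≤-refl) ∷ All.map (λ (1≤d , d≤ℓ) → 1≤d , m≤n⇒m≤1+n (below-p d≤ℓ)) boundsₜ
  where
  decₜ : Decreasing (toSteps f p)
  decₜ = proj₁ (toSteps-stepSet f rampₚ)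
  boundsₜ : All (λ d → 1 ≤ d × d < suc (length (large p))) (toSteps f p)
  boundsₜ = proj₂ (toSteps-stepSet f rampₚ)
  below-p : ∀ {d} → d < suc (length (large p)) → d < length p
  below-p d≤ℓ = ≤-<-trans (≤-pred d≤ℓ) (ramp-length-large rampₚ)

toSteps-≥2 : ∀ f {q} → Ramp q → FirstTwoEqual q → All (2 ≤_) (toSteps f q)
toSteps-≥2 zero _ _ = []
toSteps-≥2 (suc f) ramp q₁≡q₂ with rampView ramp
... | flat k refl = subst (All (2 ≤_)) (sym (toSteps-flat (suc f) (suc k))) []
... | raised {p} k rampₚ refl = subst (All (2 ≤_)) (sym (toSteps-raised f (suc k) rampₚ)) (lower rampₚ q₁≡q₂)
  where
  lower : ∀ {p} → Ramp p → FirstTwoEqual (map suc p ++ replicate (suc k) 3) →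
          All (2 ≤_) (length p ∷ toSteps f p)
  lower [3] (_ , _ , ())
  lower (xy ∷ rampₚ) (_ , _ , refl) = s≤s (s≤s z≤n) ∷ toSteps-≥2 f (xy ∷ rampₚ) (_ , _ , refl)

ramp-∷ʳ3 : ∀ s → Linked Step (s ∷ʳ 3) → Ramp (s ∷ʳ 3)
ramp-∷ʳ3 [] _ = [3]
ramp-∷ʳ3 (x ∷ []) (xy ∷ _) = xy ∷ [3]
ramp-∷ʳ3 (x ∷ y ∷ s) (xy ∷ steps) = xy ∷ ramp-∷ʳ3 (y ∷ s) steps

reverse≡33⇒ends33 : ∀ {q r} → reverse q ≡ 3 ∷ 3 ∷ r → q ≡ reverse r ++ 3 ∷ 3 ∷ []
reverse≡33⇒ends33 {q} {r} rev≡ =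
  trans (sym (reverse-involutive q)) (trans (cong reverse rev≡) (reverse-++ (3 ∷ 3 ∷ []) r))

counted-ramp : ∀ {n q} → Counted n q → Ramp q
counted-ramp {q = q} (_ , _ , steps , _ , r , rev≡) = subst Ramp (sym q≡) (ramp-∷ʳ3 (reverse r ∷ʳ 3) (subst (Linked Step) q≡ steps))
  where
  q≡ : q ≡ (reverse r ∷ʳ 3) ∷ʳ 3
  q≡ = trans (reverse≡33⇒ends33 rev≡) (sym (++-assoc (reverse r) [ 3 ] [ 3 ]))

toSteps-interior : ∀ {n q} → Counted n q → InteriorSteps (length q) (toSteps (length q) q)
toSteps-interior {q = q} c@(_ , _ , _ , q₁≡q₂ , r , rev≡) =
  proj₁ S ,
  All.zipWith (λ ((_ , d≤ℓ) , 2≤d) → 2≤d , ≤-trans (+-monoˡ-≤ 2 (≤-trans (≤-pred d≤ℓ) ℓ≤s)) s+2≤h)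
              (proj₂ S , toSteps-≥2 (length q) ramp q₁≡q₂)
  where
  ramp : Ramp q
  ramp = counted-ramp c
  S : StepSet (suc (length (large q))) (toSteps (length q) q)
  S = toSteps-stepSet (length q) ramp
  q≡ : q ≡ reverse r ++ 3 ∷ 3 ∷ []
  q≡ = reverse≡33⇒ends33 rev≡
  ℓ≤s : length (large q) ≤ length (reverse r)
  ℓ≤s = subst (λ q → length (large q) ≤ length (reverse r)) (sym q≡) (length-large-before-3 (reverse r) [ 3 ])
  s+2≤h : length (reverse r) + 2 ≤ length q
  s+2≤h = ≤-reflexive (trans (sym (length-++ (reverse r))) (cong length (sym q≡)))

-- The involution

Admissible : ℕ → ℕ → List ℕ → Set
Admissible c h E = Decreasing E × All (λ x → c ≤ x × x + c ≤ suc h) E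

StrictlyAdmissible : ℕ → ℕ → List ℕ → Set
StrictlyAdmissible c h E = Decreasing E × All (λ x → c < x × x + c ≤ h) E

stripLast : ℕ → List ℕ → Maybe (List ℕ)
stripLast c [] = nothing
stripLast c (x ∷ []) with x ≟ c
... | yes _ = just []
... | no _ = nothing
stripLast c (x ∷ y ∷ E) = Maybe.map (x ∷_) (stripLast c (y ∷ E))

shrink : ℕ → ℕ → List ℕ → Maybe (ℕ × List ℕ)
shrink c zero E = nothing
shrink c (suc h) E with c + c ≤? suc h
... | yes _ = just (h , E ∷ʳ c)
... | no _ = nothing

raise : ℕ → ℕ × List ℕ → ℕ × List ℕ
raise c (h , E) = h , (suc h ∸ c) ∷ E

move : ℕ → ℕ → List ℕ → Maybe (ℕ × List ℕ)
move c h E with stripLast c E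
move c h E | just E₀ = just (suc h , E₀)
move c h [] | nothing = shrink c h []
move c h (x ∷ E) | nothing with x + c ≟ suc h
... | yes _ = Maybe.map (raise c) (move (suc c) h E)
... | no _ = shrink c h (x ∷ E)

stripLast-∷ʳ : ∀ c E → stripLast c (E ∷ʳ c) ≡ just E
stripLast-∷ʳ c [] with c ≟ c
... | yes _ = refl
... | no c≢c = ⊥-elim (c≢c refl)
stripLast-∷ʳ c (x ∷ []) rewrite stripLast-∷ʳ c [] = refl
stripLast-∷ʳ c (x ∷ y ∷ E) rewrite stripLast-∷ʳ c (y ∷ E) = refl

stripLast-just : ∀ c E {E₀} → stripLast c E ≡ just E₀ → E ≡ E₀ ∷ʳ c
stripLast-just c (x ∷ []) eq with x ≟ c
stripLast-just c (x ∷ []) refl | yes refl = refl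
stripLast-just c (x ∷ y ∷ E) eq with stripLast c (y ∷ E) in strip
stripLast-just c (x ∷ y ∷ E) refl | just _ = cong (x ∷_) (stripLast-just c (y ∷ E) strip)

stripLast-> : ∀ c {E} → All (c <_) E → stripLast c E ≡ nothing
stripLast-> c [] = refl
stripLast-> c {x ∷ []} (c<x ∷ []) with x ≟ c
... | yes refl = ⊥-elim (<-irrefl refl c<x)
... | no _ = refl
stripLast-> c {x ∷ y ∷ E} (_ ∷ c<E) rewrite stripLast-> c c<E = refl

stripLast≡nothing⇒> : ∀ c {E} → Decreasing E → All (c ≤_) E → stripLast c E ≡ nothing → All (c <_) E
stripLast≡nothing⇒> c {[]} _ _ _ = []
stripLast≡nothing⇒> c {x ∷ []} _ (c≤x ∷ []) strip with x ≟ c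
... | no x≢c = ≤∧≢⇒< c≤x (λ c≡x → x≢c (sym c≡x)) ∷ []
stripLast≡nothing⇒> c {x ∷ y ∷ E} (x>y ∷ dec) (_ ∷ c≤E) strip with stripLast c (y ∷ E) in stripₜ
... | nothing with stripLast≡nothing⇒> c dec c≤E stripₜ
... | c<y ∷ c<E = <-trans c<y x>y ∷ c<y ∷ c<E

move-∷ʳ : ∀ c h E → move c h (E ∷ʳ c) ≡ just (suc h , E)
move-∷ʳ c h E rewrite stripLast-∷ʳ c E = refl

shrink-≤ : ∀ {c h} E → c + c ≤ suc h → shrink c (suc h) E ≡ just (h , E ∷ʳ c)
shrink-≤ {c} {h} E c+c≤ with c + c ≤? suc h
... | yes _ = refl
... | no c+c≰ = ⊥-elim (c+c≰ c+c≤)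

move-strictlyAdmissible : ∀ {c h E} → StrictlyAdmissible c (suc h) E → c + c ≤ suc h → move c (suc h) E ≡ just (h , E ∷ʳ c)
move-strictlyAdmissible {c} {h} {E} (_ , bounds) c+c≤ with stripLast c E | stripLast-> c (All.map proj₁ bounds)
move-strictlyAdmissible {c} {h} {[]} _ c+c≤ | nothing | refl = shrink-≤ [] c+c≤
move-strictlyAdmissible {c} {h} {x ∷ E} (_ , (_ , x+c≤) ∷ _) c+c≤ | nothing | refl with x + c ≟ suc (suc h)
... | yes x+c≡ = ⊥-elim (<-irrefl x+c≡ (s≤s x+c≤))
... | no _ = shrink-≤ (x ∷ E) c+c≤

move-peel : ∀ {c h x E} → All (c <_) (x ∷ E) → x + c ≡ suc h →
            move c h (x ∷ E) ≡ Maybe.map (raise c) (move (suc c) h E)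
move-peel {c} {h} {x} {E} c<xE x+c≡ with stripLast c (x ∷ E) | stripLast-> c c<xE
... | nothing | refl with x + c ≟ suc h
... | yes _ = refl
... | no x+c≢ = ⊥-elim (x+c≢ x+c≡)

decreasing-∷ʳ⁺ : ∀ {c} E → Decreasing E → All (c <_) E → Decreasing (E ∷ʳ c)
decreasing-∷ʳ⁺ [] _ _ = [-]
decreasing-∷ʳ⁺ (x ∷ []) _ (c<x ∷ []) = c<x ∷ [-]
decreasing-∷ʳ⁺ (x ∷ y ∷ E) (x>y ∷ dec) (_ ∷ c<yE) = x>y ∷ decreasing-∷ʳ⁺ (y ∷ E) dec c<yE

decreasing-∷ʳ⁻ : ∀ {c} E → Decreasing (E ∷ʳ c) → Decreasing E × All (c <_) E
decreasing-∷ʳ⁻ [] _ = [] , []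
decreasing-∷ʳ⁻ (x ∷ []) (c<x ∷ _) = [-] , c<x ∷ []
decreasing-∷ʳ⁻ (x ∷ y ∷ E) (x>y ∷ dec) with decreasing-∷ʳ⁻ (y ∷ E) dec
... | decₜ , c<yE@(c<y ∷ _) = x>y ∷ decₜ , <-trans c<y x>y ∷ c<yE

admissible-∷ʳ⁻ : ∀ {c h} E → Admissible c h (E ∷ʳ c) → StrictlyAdmissible c (suc h) E × c + c ≤ suc h
admissible-∷ʳ⁻ E (dec , bounds) with decreasing-∷ʳ⁻ E dec | Allₚ.∷ʳ⁻ bounds
... | decₑ , c<E | boundsₑ , (_ , c+c≤) =
  (decₑ , All.zipWith (λ (c<x , (_ , x+c≤)) → c<x , x+c≤) (c<E , boundsₑ)) , c+c≤

admissible-∷ʳ⁺ : ∀ {c h} E → StrictlyAdmissible c (suc h) E → c + c ≤ suc h → Admissible c h (E ∷ʳ c)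
admissible-∷ʳ⁺ E (dec , bounds) c+c≤ =
  decreasing-∷ʳ⁺ E dec (All.map proj₁ bounds) ,
  Allₚ.∷ʳ⁺ (All.map (λ (c<x , x+c≤) → <⇒≤ c<x , x+c≤) bounds) (≤-refl , c+c≤)

strictlyAdmissible⇒admissible : ∀ {c h E} → StrictlyAdmissible c h E → Admissible c h E
strictlyAdmissible⇒admissible (dec , bounds) = dec , All.map (λ (c<x , x+c≤) → <⇒≤ c<x , m≤n⇒m≤1+n x+c≤) bounds

Adjacent : ℕ → ℕ → Set
Adjacent h h′ = h′ ≡ suc h ⊎ h ≡ suc h′

record Moved (c h : ℕ) (E : List ℕ) (h′ : ℕ) (E′ : List ℕ) : Set where
  field
    admissible : Admissible c h′ E′
    moves-back : move c h′ E′ ≡ just (h , E)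
    weight-≡   : c * h + sum E ≡ c * h′ + sum E′
    adjacent   : Adjacent h h′
    room       : c + c ≤ suc h′

weight-∷ʳ : ∀ c h E → c * h + sum (E ∷ʳ c) ≡ c * suc h + sum E
weight-∷ʳ c h E = trans (cong (c * h +_) (sum-++ E [ c ])) (regroup c h (sum E))
  where
  regroup : ∀ c h s → c * h + (s + (c + 0)) ≡ c * suc h + s
  regroup = solve-∀

remove-moved : ∀ {c h} E → Admissible c h (E ∷ʳ c) → Moved c h (E ∷ʳ c) (suc h) E
remove-moved {c} {h} E adm with admissible-∷ʳ⁻ E adm
... | I , c+c≤ = record
  { admissible = strictlyAdmissible⇒admissible I
  ; moves-back = move-strictlyAdmissible I c+c≤
  ; weight-≡   = weight-∷ʳ c h E
  ; adjacent   = inj₁ refl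
  ; room       = m≤n⇒m≤1+n c+c≤
  }

append-moved : ∀ {c h E} → StrictlyAdmissible c (suc h) E → c + c ≤ suc h → Moved c (suc h) E h (E ∷ʳ c)
append-moved {c} {h} {E} I c+c≤ = record
  { admissible = admissible-∷ʳ⁺ E I c+c≤
  ; moves-back = move-∷ʳ c h E
  ; weight-≡   = sym (weight-∷ʳ c h E)
  ; adjacent   = inj₂ refl
  ; room       = c+c≤
  }

peel-weight : ∀ c h x s → x + c ≡ suc h → c * h + (x + s) + c ≡ suc (suc c * h + s)
peel-weight c h x s x+c≡ = begin
  c * h + (x + s) + c   ≡⟨ regroup c h x s ⟩
  c * h + s + (x + c)   ≡⟨ cong (c * h + s +_) x+c≡ ⟩
  c * h + s + suc h     ≡⟨ regroup′ c h s ⟩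
  suc (suc c * h + s)   ∎
  where
  open ≡-Reasoning
  regroup : ∀ c h x s → c * h + (x + s) + c ≡ c * h + s + (x + c)
  regroup = solve-∀
  regroup′ : ∀ c h s → c * h + s + suc h ≡ suc (suc c * h + s)
  regroup′ = solve-∀

peel-moved : ∀ {c h x E h″ E″} → x + c ≡ suc h → All (c <_) (x ∷ E) → Moved (suc c) h E h″ E″ →
             Moved c h (x ∷ E) h″ ((suc h″ ∸ c) ∷ E″)
peel-moved {c} {h} {x} {E} {h″} {E″} x+c≡ c<xE inner = record
  { admissible = decreasing-∷ dec″ (All.map (λ (_ , y+c+1≤) → below-x″ y+c+1≤) bounds″) ,
                 (<⇒≤ c<x″ , ≤-reflexive x″+c≡)
                 ∷ All.map (λ (c<y , y+c+1≤) → <⇒≤ c<y , ≤-trans (+-monoʳ-≤ _ (n≤1+n c)) y+c+1≤) bounds″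
  ; moves-back = begin
      move c h″ (x″ ∷ E″)                 ≡⟨ move-peel (c<x″ ∷ All.map proj₁ bounds″) x″+c≡ ⟩
      Maybe.map (raise c) (move (suc c) h″ E″)  ≡⟨ cong (Maybe.map (raise c)) moves-back ⟩
      just (h , (suc h ∸ c) ∷ E)          ≡⟨ cong (λ y → just (h , y ∷ E)) (trans (cong (_∸ c) (sym x+c≡)) (m+n∸n≡m x c)) ⟩
      just (h , x ∷ E)                    ∎
  ; weight-≡   = +-cancelʳ-≡ c _ _ (begin
      c * h + (x + sum E) + c             ≡⟨ peel-weight c h x (sum E) x+c≡ ⟩
      suc (suc c * h + sum E)             ≡⟨ cong suc weight-≡ ⟩
      suc (suc c * h″ + sum E″)           ≡⟨ peel-weight c h″ x″ (sum E″) x″+c≡ ⟨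
      c * h″ + (x″ + sum E″) + c          ∎)
  ; adjacent   = adjacent
  ; room       = ≤-trans (+-mono-≤ (n≤1+n c) (n≤1+n c)) room
  }
  where
  open Moved inner
  open ≡-Reasoning
  x″ : ℕ
  x″ = suc h″ ∸ c
  dec″ : Decreasing E″
  dec″ = proj₁ admissible
  bounds″ : All (λ y → suc c ≤ y × y + suc c ≤ suc h″) E″
  bounds″ = proj₂ admissible
  x″+c≡ : x″ + c ≡ suc h″
  x″+c≡ = m∸n+n≡m (≤-trans (m≤m+n c c) (≤-trans (+-mono-≤ (n≤1+n c) (n≤1+n c)) room))
  c<x″ : c < x″
  c<x″ = +-cancelʳ-< c c x″ (subst (c + c <_) (sym x″+c≡) (≤-trans (s≤s (+-monoʳ-≤ c (n≤1+n c))) room))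
  below-x″ : ∀ {y} → y + suc c ≤ suc h″ → y < x″
  below-x″ {y} y+c+1≤ = +-cancelʳ-< c y x″ (subst₂ _≤_ (+-suc y c) (sym x″+c≡) y+c+1≤)

shrink-moved : ∀ {c h E h′ E′} → StrictlyAdmissible c h E → shrink c h E ≡ just (h′ , E′) → Moved c h E h′ E′
shrink-moved {c} {suc h} I eq with c + c ≤? suc h
shrink-moved {c} {suc h} I refl | yes c+c≤ = append-moved I c+c≤

admissible⇒strictlyAdmissible : ∀ {c h x E} → Admissible c h (x ∷ E) → All (c <_) (x ∷ E) → x + c ≢ suc h →
                      StrictlyAdmissible c h (x ∷ E)
admissible⇒strictlyAdmissible {c} {h} {x} {E} (dec , (_ , x+c≤) ∷ bounds) c<xE x+c≢ =
  dec , All.zipWith (λ (c<y , y+c≤) → c<y , y+c≤) (c<xE , x+c≤h ∷ All.map below bounds′)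
  where
  x+c≤h : x + c ≤ h
  x+c≤h = ≤-pred (≤∧≢⇒< x+c≤ x+c≢)
  bounds′ : All (_< x) E
  bounds′ = decreasing-head dec
  below : ∀ {y} → y < x → y + c ≤ h
  below y<x = ≤-trans (+-monoˡ-≤ c (<⇒≤ y<x)) x+c≤h

admissible-tail : ∀ {c h x E} → Admissible c h (x ∷ E) → All (c <_) (x ∷ E) → x + c ≡ suc h →
                  Admissible (suc c) h E
admissible-tail {c} {h} {x} (dec , _) (_ ∷ c<E) x+c≡ =
  Linked.tail dec ,
  All.zipWith (λ (c<y , y<x) → c<y , subst₂ _≤_ (sym (+-suc _ c)) x+c≡ (+-monoˡ-≤ c y<x))
              (c<E , decreasing-head dec)

move-moved : ∀ {c h E h′ E′} → Admissible c h E → move c h E ≡ just (h′ , E′) → Moved c h E h′ E′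
move-moved {c} {h} {E} adm eq with stripLast c E in strip
... | just E₀ with refl ← stripLast-just c E strip | refl ← eq = remove-moved E₀ adm
move-moved {c} {h} {[]} adm eq | nothing = shrink-moved ([] , []) eq
move-moved {c} {h} {x ∷ E} adm eq | nothing with x + c ≟ suc h | stripLast≡nothing⇒> c (proj₁ adm) (All.map proj₁ (proj₂ adm)) strip
... | no x+c≢ | c<xE = shrink-moved (admissible⇒strictlyAdmissible adm c<xE x+c≢) eq
... | yes x+c≡ | c<xE with move (suc c) h E in inner
...   | just (h″ , E″) with refl ← eq = peel-moved x+c≡ c<xE (move-moved (admissible-tail adm c<xE x+c≡) inner)

-- Fixed points of the involution

data Fixed : ℕ → ℕ → List ℕ → Set where
  []  : ∀ {c h} → h < c + c → Fixed c h []
  _∷_ : ∀ {c h x E} → c < x × x + c ≡ suc h → Fixed (suc c) h E → Fixed c h (x ∷ E)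

Fixed⇒bounds : ∀ {c h E} → Fixed c h E → All (λ x → c < x × x + c ≤ suc h) E
Fixed⇒bounds ([] _) = []
Fixed⇒bounds {c} ((c<x , x+c≡) ∷ fixed) =
  (c<x , ≤-reflexive x+c≡)
  ∷ All.map (λ (c<y , y+c≤) → <-trans (n<1+n c) c<y , ≤-trans (+-monoʳ-≤ _ (n≤1+n c)) y+c≤) (Fixed⇒bounds fixed)

Fixed⇒admissible : ∀ {c h E} → Fixed c h E → Admissible c h E
Fixed⇒admissible fixed = decreasing fixed , All.map (λ (c<x , x+c≤) → <⇒≤ c<x , x+c≤) (Fixed⇒bounds fixed)
  where
  decreasing : ∀ {c h E} → Fixed c h E → Decreasing E
  decreasing ([] _) = []
  decreasing {c} ((_ , x+c≡) ∷ fixed) =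
    decreasing-∷ (decreasing fixed)
      (All.map (λ (_ , y+c+1≤) → +-cancelʳ-< c _ _ (subst₂ _≤_ (+-suc _ c) (sym x+c≡) y+c+1≤)) (Fixed⇒bounds fixed))

Fixed⇒move≡nothing : ∀ {c h E} → Fixed c h E → move c h E ≡ nothing
Fixed⇒move≡nothing {c} {suc h} ([] h<c+c) = shrink-> where
  shrink-> : shrink c (suc h) [] ≡ nothing
  shrink-> with c + c ≤? suc h
  ... | yes c+c≤ = ⊥-elim (<⇒≱ h<c+c c+c≤)
  ... | no _ = refl
Fixed⇒move≡nothing {c} {zero} ([] _) = refl
Fixed⇒move≡nothing fixed@((_ , x+c≡) ∷ fixedₜ) =
  trans (move-peel (All.map proj₁ (Fixed⇒bounds fixed)) x+c≡) (cong (Maybe.map _) (Fixed⇒move≡nothing fixedₜ))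

just≢nothing : ∀ {A : Set} {a : A} → just a ≢ nothing
just≢nothing ()

-- For c = h = 0 the move does nothing although h < c + c fails.
move≡nothing⇒Fixed : ∀ {c h E} → 0 < c → Admissible c h E → move c h E ≡ nothing → Fixed c h E
move≡nothing⇒Fixed {c} {h} {E} 0<c adm eq with stripLast c E in strip
move≡nothing⇒Fixed {c} {h} {[]} 0<c adm eq | nothing = [] (shrink≡nothing h eq)
  where
  shrink≡nothing : ∀ h → shrink c h [] ≡ nothing → h < c + c
  shrink≡nothing zero _ = ≤-trans 0<c (m≤m+n c c)
  shrink≡nothing (suc h) eq with c + c ≤? suc h
  ... | no c+c≰ = ≰⇒> c+c≰
move≡nothing⇒Fixed {c} {h} {x ∷ E} 0<c adm eq | nothing
  with x + c ≟ suc h | stripLast≡nothing⇒> c (proj₁ adm) (All.map proj₁ (proj₂ adm)) strip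
... | yes x+c≡ | c<xE@(c<x ∷ _) with move (suc c) h E in inner
...   | nothing = (c<x , x+c≡) ∷ move≡nothing⇒Fixed (s≤s z≤n) (admissible-tail adm c<xE x+c≡) inner
move≡nothing⇒Fixed {c} {h} {x ∷ E} 0<c adm eq | nothing | no x+c≢ | c<xE@(c<x ∷ _)
  with h | admissible⇒strictlyAdmissible adm c<xE x+c≢
... | zero | (_ , (_ , x+c≤0) ∷ _) = ⊥-elim (n≮0 (<-≤-trans (<-≤-trans (≤-<-trans z≤n c<x) (m≤m+n x c)) x+c≤0))
... | suc h | (_ , (_ , x+c≤) ∷ _) =
  ⊥-elim (just≢nothing (trans (sym (shrink-≤ (x ∷ E) (≤-trans (+-monoˡ-≤ c (<⇒≤ c<x)) x+c≤))) eq))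

head-room : ∀ {c h x} → c < x → x + c ≡ suc h → c + c ≤ h
head-room {c} c<x x+c≡ = ≤-pred (subst (suc (c + c) ≤_) x+c≡ (+-monoˡ-≤ c c<x))

Fixed-unique : ∀ {c h E E′} → Fixed c h E → Fixed c h E′ → E ≡ E′
Fixed-unique ([] _) ([] _) = refl
Fixed-unique {c} ((_ , x+c≡) ∷ fixed) ((_ , x′+c≡) ∷ fixed′) =
  cong₂ _∷_ (+-cancelʳ-≡ c _ _ (trans x+c≡ (sym x′+c≡))) (Fixed-unique fixed fixed′)
Fixed-unique ([] h<c+c) ((c<x , x+c≡) ∷ _) = ⊥-elim (<⇒≱ h<c+c (head-room c<x x+c≡))
Fixed-unique ((c<x , x+c≡) ∷ _) ([] h<c+c) = ⊥-elim (<⇒≱ h<c+c (head-room c<x x+c≡))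

Fixed-shift : ∀ {c h E} → Fixed c h E → Fixed (suc c) (suc (suc h)) (map suc E)
Fixed-shift {c} {h} ([] h<c+c) = [] (subst (suc (suc (suc h)) ≤_) (sym (cong suc (+-suc c c))) (s≤s (s≤s h<c+c)))
Fixed-shift {c} ((c<x , x+c≡) ∷ fixed) = (s≤s c<x , cong suc (trans (+-suc _ c) (cong suc x+c≡))) ∷ Fixed-shift fixed

twoIf : Bool → List ℕ
twoIf true = [ 2 ]
twoIf false = []

-- The drop at 2 is kept apart as the flag two: the involution acts on the other drops.
record Code : Set where
  constructor code
  field
    height : ℕ
    steps  : List ℕ
    two    : Bool

Valid : Code → Set
Valid (code h E b) = 3 ≤ h × Admissible 3 h E × (b ≡ true → 4 ≤ h)

decode : Code → List ℕ
decode (code h E b) = fromSteps h (E ++ twoIf b)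

weight : Code → ℕ
weight (code h E b) = 3 * h + sum (E ++ twoIf b)

weight-split : ∀ h E b → weight (code h E b) ≡ 3 * h + sum E + sum (twoIf b)
weight-split h E b = trans (cong (3 * h +_) (sum-++ E (twoIf b))) (sym (+-assoc (3 * h) (sum E) _))

splitTwo : List ℕ → List ℕ × Bool
splitTwo D with stripLast 2 D
... | just E = E , true
... | nothing = D , false

withHeight : ℕ → List ℕ × Bool → Code
withHeight h (E , b) = code h E b

encode : List ℕ → Code
encode q = withHeight (length q) (splitTwo (toSteps (length q) q))

valid⇒interiorSteps : ∀ {h E b} → Valid (code h E b) → InteriorSteps h (E ++ twoIf b)
valid⇒interiorSteps {h} {E} {b} (_ , (dec , bounds) , 4≤h) = decreasing b , Allₚ.++⁺ boundsₑ (boundsₜ b 4≤h)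
  where
  boundsₑ : All (λ d → 2 ≤ d × d + 2 ≤ h) E
  boundsₑ = All.map (λ (3≤x , x+3≤) → ≤-trans (n≤1+n 2) 3≤x , ≤-pred (subst (_≤ suc h) (+-suc _ 2) x+3≤)) bounds
  boundsₜ : ∀ b → (b ≡ true → 4 ≤ h) → All (λ d → 2 ≤ d × d + 2 ≤ h) (twoIf b)
  boundsₜ true 4≤h = (≤-refl , 4≤h refl) ∷ []
  boundsₜ false _ = []
  decreasing : ∀ b → Decreasing (E ++ twoIf b)
  decreasing true = decreasing-∷ʳ⁺ E dec (All.map (λ (3≤x , _) → 3≤x) bounds)
  decreasing false = subst Decreasing (sym (++-identityʳ E)) dec

decode-counted : ∀ {x} → Valid x → Counted (weight x) (decode x)
decode-counted v@(3≤h , _) = fromSteps-counted 3≤h (valid⇒interiorSteps v)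

length-decode : ∀ {x} → Valid x → length (decode x) ≡ Code.height x
length-decode {code h E b} v = length-fromSteps h (E ++ twoIf b) (interiorSteps⇒stepSet (valid⇒interiorSteps v))

splitTwo-++ : ∀ E b → All (2 <_) E → splitTwo (E ++ twoIf b) ≡ (E , b)
splitTwo-++ E true _ rewrite stripLast-∷ʳ 2 E = refl
splitTwo-++ E false 2<E rewrite ++-identityʳ E | stripLast-> 2 2<E = refl

encode-decode : ∀ {x} → Valid x → encode (decode x) ≡ x
encode-decode {code h E b} v@(_ , (_ , bounds) , _) with S ← interiorSteps⇒stepSet (valid⇒interiorSteps v)
  rewrite length-fromSteps h (E ++ twoIf b) S | toSteps-fromSteps h S ≤-refl | splitTwo-++ E b (All.map proj₁ bounds) = refl

interiorSteps⇒admissible : ∀ {h E} → InteriorSteps h E → All (2 <_) E → Admissible 3 h E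
interiorSteps⇒admissible {h} (dec , bounds) 2<E =
  dec , All.zipWith (λ (3≤x , (_ , x+2≤)) → 3≤x , subst (_≤ suc h) (sym (+-suc _ 2)) (s≤s x+2≤)) (2<E , bounds)

splitTwo-valid : ∀ {h D} → 3 ≤ h → InteriorSteps h D →
                 Valid (withHeight h (splitTwo D)) × decode (withHeight h (splitTwo D)) ≡ fromSteps h D
splitTwo-valid {h} {D} 3≤h I@(dec , bounds) with stripLast 2 D in strip
... | nothing = (3≤h , interiorSteps⇒admissible I 2<D , λ ()) , cong (fromSteps h) (++-identityʳ D)
  where
  2<D : All (2 <_) D
  2<D = stripLast≡nothing⇒> 2 dec (All.map proj₁ bounds) strip
... | just E with refl ← stripLast-just 2 D strip with decreasing-∷ʳ⁻ E dec | Allₚ.∷ʳ⁻ bounds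
...   | decₑ , 2<E | boundsₑ , (_ , 4≤h) = (3≤h , interiorSteps⇒admissible (decₑ , boundsₑ) 2<E , λ _ → 4≤h) , refl

encode-valid : ∀ {n q} → Counted n q → Valid (encode q)
encode-valid c@(_ , 3≤h , _) = proj₁ (splitTwo-valid 3≤h (toSteps-interior c))

decode-encode : ∀ {n q} → Counted n q → decode (encode q) ≡ q
decode-encode {q = q} c@(_ , 3≤h , _) =
  trans (proj₂ (splitTwo-valid 3≤h (toSteps-interior c))) (fromSteps-toSteps (length q) (counted-ramp c) ≤-refl)

weight-encode : ∀ {n q} → Counted n q → weight (encode q) ≡ n
weight-encode {n} {q} c = begin
  weight (encode q)         ≡⟨ proj₁ (decode-counted (encode-valid c)) ⟨
  sum (decode (encode q))   ≡⟨ cong sum (decode-encode c) ⟩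
  sum q                     ≡⟨ proj₁ c ⟩
  n                         ∎
  where open ≡-Reasoning

-- Staircases and the exceptional forms

staircase : ℕ → List ℕ
staircase (suc (suc h@(suc (suc (suc (suc _)))))) = h ∷ map suc (staircase h)
staircase _ = []

staircase-fixed : ∀ h → 3 ≤ h → Fixed 3 h (staircase h)
staircase-fixed 3 _ = [] (s≤s (s≤s (s≤s (s≤s z≤n))))
staircase-fixed 4 _ = [] (s≤s (s≤s (s≤s (s≤s (s≤s z≤n)))))
staircase-fixed 5 _ = [] (s≤s (s≤s (s≤s (s≤s (s≤s (s≤s z≤n))))))
staircase-fixed (suc (suc h@(suc (suc (suc (suc _)))))) _ =
  (s≤s (s≤s (s≤s (s≤s z≤n))) , +-comm h 3) ∷ Fixed-shift (staircase-fixed h (s≤s (s≤s (s≤s z≤n))))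
staircase-fixed 1 (s≤s ())
staircase-fixed 2 (s≤s (s≤s ()))

fixedWeight : ℕ → Bool → ℕ
fixedWeight h b = weight (code h (staircase h) b)

staircase-mono : ∀ h → sum (staircase h) ≤ sum (staircase (suc h)) × length (staircase h) ≤ length (staircase (suc h))
staircase-mono (suc (suc h@(suc (suc (suc (suc _)))))) with staircase-mono h
... | sum≤ , length≤ =
  +-mono-≤ (n≤1+n h) (subst₂ _≤_ (sym (sum-map-suc (staircase h))) (sym (sum-map-suc (staircase (suc h)))) (+-mono-≤ sum≤ length≤)) ,
  s≤s (subst₂ _≤_ (sym (length-map suc (staircase h))) (sym (length-map suc (staircase (suc h)))) length≤)
staircase-mono 0 = z≤n , z≤n
staircase-mono 1 = z≤n , z≤n
staircase-mono 2 = z≤n , z≤n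
staircase-mono 3 = z≤n , z≤n
staircase-mono 4 = z≤n , z≤n
staircase-mono 5 = z≤n , z≤n

fixedWeight-split : ∀ h b → fixedWeight h b ≡ 3 * h + sum (staircase h) + sum (twoIf b)
fixedWeight-split h = weight-split h (staircase h)

fixedWeight-<-suc : ∀ h b b′ → fixedWeight h b < fixedWeight (suc h) b′
fixedWeight-<-suc h b b′ = begin-strict
  fixedWeight h b                                   ≡⟨ fixedWeight-split h b ⟩
  3 * h + sum (staircase h) + sum (twoIf b)         ≤⟨ +-monoʳ-≤ (3 * h + sum (staircase h)) (twoIf≤2 b) ⟩
  3 * h + sum (staircase h) + 2                     <⟨ +-monoʳ-< (3 * h + sum (staircase h)) (n<1+n 2) ⟩
  3 * h + sum (staircase h) + 3                     ≡⟨ regroup h (sum (staircase h)) ⟩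
  3 * suc h + sum (staircase h)                     ≤⟨ +-monoʳ-≤ (3 * suc h) (proj₁ (staircase-mono h)) ⟩
  3 * suc h + sum (staircase (suc h))               ≤⟨ m≤m+n _ _ ⟩
  3 * suc h + sum (staircase (suc h)) + sum (twoIf b′)  ≡⟨ fixedWeight-split (suc h) b′ ⟨
  fixedWeight (suc h) b′                            ∎
  where
  open ≤-Reasoning
  twoIf≤2 : ∀ b → sum (twoIf b) ≤ 2
  twoIf≤2 true = ≤-refl
  twoIf≤2 false = z≤n
  regroup : ∀ h s → 3 * h + s + 3 ≡ 3 * suc h + s
  regroup = solve-∀

fixedWeight-< : ∀ {h h′} b b′ → h < h′ → fixedWeight h b < fixedWeight h′ b′
fixedWeight-< {h} {suc h′} b b′ h<1+h′ with m≤n⇒m<n∨m≡n (≤-pred h<1+h′)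
... | inj₁ h<h′ = <-trans (fixedWeight-< b false h<h′) (fixedWeight-<-suc h′ false b′)
... | inj₂ refl = fixedWeight-<-suc h b b′

fixedWeight-injective : ∀ {h h′ b b′} → fixedWeight h b ≡ fixedWeight h′ b′ → h ≡ h′ × b ≡ b′
fixedWeight-injective {h} {h′} {b} {b′} eq with <-cmp h h′
... | tri< h<h′ _ _ = ⊥-elim (<-irrefl eq (fixedWeight-< b b′ h<h′))
... | tri> _ _ h>h′ = ⊥-elim (<-irrefl (sym eq) (fixedWeight-< b′ b h>h′))
... | tri≈ _ refl _ = refl , twoIf-injective b b′ (+-cancelˡ-≡ (3 * h + sum (staircase h)) _ _
                               (trans (sym (fixedWeight-split h b)) (trans eq (fixedWeight-split h b′))))
  where
  twoIf-injective : ∀ b b′ → sum (twoIf b) ≡ sum (twoIf b′) → b ≡ b′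
  twoIf-injective true true _ = refl
  twoIf-injective false false _ = refl

staircase-step : ∀ {h} → 4 ≤ h → staircase (2 + h) ≡ h ∷ map suc (staircase h)
staircase-step (s≤s (s≤s (s≤s (s≤s _)))) = refl

-- 3 * u sits on the left so that no subtraction occurs.
sum-staircase : ∀ r u → staircase r ≡ [] → 4 ≤ r →
                2 * sum (staircase (u * 2 + r)) + 3 * u ≡ 3 * (u * u) + 2 * (r * u) × length (staircase (u * 2 + r)) ≡ u
sum-staircase r zero st≡[] _ rewrite st≡[] = sym (cong (2 *_) (*-zeroʳ r)) , refl
sum-staircase r (suc u) st≡[] 4≤r
  rewrite staircase-step (≤-trans 4≤r (m≤n+m r (u * 2))) | sum-map-suc (staircase (u * 2 + r)) | length-map suc (staircase (u * 2 + r))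
  with sum-staircase r u st≡[] 4≤r
... | sum≡ , length≡ rewrite length≡ = step r u (sum (staircase (u * 2 + r))) sum≡ , refl
  where
  step : ∀ r u S → 2 * S + 3 * u ≡ 3 * (u * u) + 2 * (r * u) →
         2 * (u * 2 + r + (S + u)) + 3 * suc u ≡ 3 * (suc u * suc u) + 2 * (r * suc u)
  step r u S IH = begin
    2 * (u * 2 + r + (S + u)) + 3 * suc u        ≡⟨ regroup r u S ⟩
    (2 * S + 3 * u) + (6 * u + 2 * r + 3)        ≡⟨ cong (_+ (6 * u + 2 * r + 3)) IH ⟩
    3 * (u * u) + 2 * (r * u) + (6 * u + 2 * r + 3)  ≡⟨ regroup′ r u ⟩
    3 * (suc u * suc u) + 2 * (r * suc u)        ∎
    where
    open ≡-Reasoning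
    regroup : ∀ r u S → 2 * (u * 2 + r + (S + u)) + 3 * suc u ≡ (2 * S + 3 * u) + (6 * u + 2 * r + 3)
    regroup = solve-∀
    regroup′ : ∀ r u → 3 * (u * u) + 2 * (r * u) + (6 * u + 2 * r + 3) ≡ 3 * (suc u * suc u) + 2 * (r * suc u)
    regroup′ = solve-∀

-- The solver lemmas spell x ^ 2 out as its unfolding x * (x * 1).
twice-fixedWeight-even : ∀ t b → 2 ≤ t → 2 * fixedWeight (t + t) b + (t + 1) ≡ 3 * (t + 1) ^ 2 + 2 * sum (twoIf b)
twice-fixedWeight-even t@(suc (suc u)) b _ = +-cancelʳ-≡ (3 * u) _ _ (begin
  2 * fixedWeight (t + t) b + (t + 1) + 3 * u
    ≡⟨ cong (λ w → 2 * w + (t + 1) + 3 * u) (fixedWeight-split (t + t) b) ⟩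
  2 * (3 * (t + t) + sum (staircase (t + t)) + B) + (t + 1) + 3 * u
    ≡⟨ cong (λ h → 2 * (3 * (t + t) + sum (staircase h) + B) + (t + 1) + 3 * u) (t+t≡ u) ⟩
  2 * (3 * (t + t) + S + B) + (t + 1) + 3 * u
    ≡⟨ regroup u S B ⟩
  (2 * S + 3 * u) + (13 * u + 27 + 2 * B)
    ≡⟨ cong (_+ (13 * u + 27 + 2 * B)) (proj₁ (sum-staircase 4 u refl ≤-refl)) ⟩
  3 * (u * u) + 2 * (4 * u) + (13 * u + 27 + 2 * B)
    ≡⟨ regroup′ u B ⟩
  3 * (t + 1) ^ 2 + 2 * B + 3 * u ∎)
  where
  open ≡-Reasoning
  S B : ℕ
  S = sum (staircase (u * 2 + 4))
  B = sum (twoIf b)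
  t+t≡ : ∀ u → suc (suc u) + suc (suc u) ≡ u * 2 + 4
  t+t≡ = solve-∀
  regroup : ∀ u S B → 2 * (3 * (suc (suc u) + suc (suc u)) + S + B) + (suc (suc u) + 1) + 3 * u
                      ≡ (2 * S + 3 * u) + (13 * u + 27 + 2 * B)
  regroup = solve-∀
  regroup′ : ∀ u B → 3 * (u * u) + 2 * (4 * u) + (13 * u + 27 + 2 * B)
                     ≡ 3 * ((suc (suc u) + 1) * ((suc (suc u) + 1) * 1)) + 2 * B + 3 * u
  regroup′ = solve-∀
twice-fixedWeight-even 1 b (s≤s ())

twice-fixedWeight-odd : ∀ t b → 2 ≤ t → 2 * fixedWeight (suc (t + t)) b ≡ 3 * (t + 1) ^ 2 + t + 1 + 2 * sum (twoIf b)
twice-fixedWeight-odd t@(suc (suc u)) b _ = +-cancelʳ-≡ (3 * u) _ _ (begin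
  2 * fixedWeight (suc (t + t)) b + 3 * u
    ≡⟨ cong (λ w → 2 * w + 3 * u) (fixedWeight-split (suc (t + t)) b) ⟩
  2 * (3 * suc (t + t) + sum (staircase (suc (t + t))) + B) + 3 * u
    ≡⟨ cong (λ h → 2 * (3 * suc (t + t) + sum (staircase h) + B) + 3 * u) (1+t+t≡ u) ⟩
  2 * (3 * suc (t + t) + S + B) + 3 * u
    ≡⟨ regroup u S B ⟩
  (2 * S + 3 * u) + (12 * u + 30 + 2 * B)
    ≡⟨ cong (_+ (12 * u + 30 + 2 * B)) (proj₁ (sum-staircase 5 u refl (n≤1+n 4))) ⟩
  3 * (u * u) + 2 * (5 * u) + (12 * u + 30 + 2 * B)
    ≡⟨ regroup′ u B ⟩
  3 * (t + 1) ^ 2 + t + 1 + 2 * B + 3 * u ∎)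
  where
  open ≡-Reasoning
  S B : ℕ
  S = sum (staircase (u * 2 + 5))
  B = sum (twoIf b)
  1+t+t≡ : ∀ u → suc (suc (suc u) + suc (suc u)) ≡ u * 2 + 5
  1+t+t≡ = solve-∀
  regroup : ∀ u S B → 2 * (3 * suc (suc (suc u) + suc (suc u)) + S + B) + 3 * u
                      ≡ (2 * S + 3 * u) + (12 * u + 30 + 2 * B)
  regroup = solve-∀
  regroup′ : ∀ u B → 3 * (u * u) + 2 * (5 * u) + (12 * u + 30 + 2 * B)
                     ≡ 3 * ((suc (suc u) + 1) * ((suc (suc u) + 1) * 1)) + suc (suc u) + 1 + 2 * B + 3 * u
  regroup′ = solve-∀
twice-fixedWeight-odd 1 b (s≤s ())

twice-fixedWeight-odd-true : ∀ t → 2 ≤ t → 2 * fixedWeight (suc (t + t)) true ≡ 3 * suc t ^ 2 + suc t + 4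
twice-fixedWeight-odd-true t 2≤t = trans (twice-fixedWeight-odd t true 2≤t) (regroup t)
  where
  regroup : ∀ t → 3 * ((t + 1) * ((t + 1) * 1)) + t + 1 + 2 * 2 ≡ 3 * (suc t * (suc t * 1)) + suc t + 4
  regroup = solve-∀

t+1≤3[t+1]² : ∀ t → t + 1 ≤ 3 * (t + 1) ^ 2
t+1≤3[t+1]² t = ≤-trans (m≤m+n (t + 1) _) (≤-reflexive (expand t))
  where
  expand : ∀ t → t + 1 + (3 * (t * t) + 5 * t + 2) ≡ 3 * ((t + 1) * ((t + 1) * 1))
  expand = solve-∀

formB⇒ : ∀ {a} t → a ≡ 3 * (t + 1) ^ 2 ∸ t ∸ 1 → a + (t + 1) ≡ 3 * (t + 1) ^ 2
formB⇒ t a≡ = trans (cong (_+ (t + 1)) (trans a≡ (∸-+-assoc _ t 1))) (m∸n+n≡m (t+1≤3[t+1]² t))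

formB⇐ : ∀ {a} t → a + (t + 1) ≡ 3 * (t + 1) ^ 2 → a ≡ 3 * (t + 1) ^ 2 ∸ t ∸ 1
formB⇐ {a} t eq = trans (sym (m+n∸n≡m a (t + 1))) (trans (cong (_∸ (t + 1)) eq) (sym (∸-+-assoc _ t 1)))

formC-shift : ∀ t → 3 * (t + 1) ^ 2 ∸ t + 3 + (t + 1) ≡ 3 * (t + 1) ^ 2 + 4
formC-shift t = begin
  c ∸ t + 3 + (t + 1)    ≡⟨ regroup (c ∸ t) t ⟩
  c ∸ t + t + 4          ≡⟨ cong (_+ 4) (m∸n+n≡m (≤-trans (m≤m+n t 1) (t+1≤3[t+1]² t))) ⟩
  c + 4                  ∎
  where
  open ≡-Reasoning
  c : ℕ
  c = 3 * (t + 1) ^ 2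
  regroup : ∀ d t → d + 3 + (t + 1) ≡ d + t + 4
  regroup = solve-∀

formC⇒ : ∀ {a} t → a ≡ 3 * (t + 1) ^ 2 ∸ t + 3 → a + (t + 1) ≡ 3 * (t + 1) ^ 2 + 4
formC⇒ t refl = formC-shift t

formC⇐ : ∀ {a} t → a + (t + 1) ≡ 3 * (t + 1) ^ 2 + 4 → a ≡ 3 * (t + 1) ^ 2 ∸ t + 3
formC⇐ t eq = +-cancelʳ-≡ (t + 1) _ _ (trans eq (sym (formC-shift t)))

height-cases : ∀ h → 3 ≤ h → h ≡ 3 ⊎ (∃[ t ] 2 ≤ t × h ≡ t + t) ⊎ (∃[ t ] 2 ≤ t × h ≡ suc (t + t))
height-cases 3 _ = inj₁ refl
height-cases 4 _ = inj₂ (inj₁ (2 , ≤-refl , refl))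
height-cases 5 _ = inj₂ (inj₂ (2 , ≤-refl , refl))
height-cases (suc (suc h@(suc (suc (suc (suc _)))))) _ with height-cases h (s≤s (s≤s (s≤s z≤n)))
... | inj₂ (inj₁ (t , 2≤t , h≡)) =
  inj₂ (inj₁ (suc t , m≤n⇒m≤1+n 2≤t , trans (cong (λ m → suc (suc m)) h≡) (cong suc (sym (+-suc t t)))))
... | inj₂ (inj₂ (t , 2≤t , h≡)) =
  inj₂ (inj₂ (suc t , m≤n⇒m≤1+n 2≤t , cong (λ m → suc (suc m)) (trans h≡ (sym (+-suc t t)))))
height-cases 1 (s≤s ())
height-cases 2 (s≤s (s≤s ()))

t*2≡t+t : ∀ t → t * 2 ≡ t + t
t*2≡t+t t = trans (*-comm t 2) (cong (t +_) (+-identityʳ t))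

even-%2 : ∀ t → (t + t) % 2 ≡ 0
even-%2 t = subst (λ m → m % 2 ≡ 0) (t*2≡t+t t) (m*n%n≡0 t 2)

odd-%2 : ∀ t → suc (t + t) % 2 ≡ 1
odd-%2 t = subst (λ m → suc m % 2 ≡ 1) (t*2≡t+t t) ([m+kn]%n≡m%n 1 t 2)

ValidHeight : ℕ → Bool → Set
ValidHeight h b = 3 ≤ h × (b ≡ true → 4 ≤ h)

fixedWeight-form : ∀ {h b} → ValidHeight h b →
                   (h % 2 ≡ 1 × (FormA (fixedWeight h b) ⊎ FormD (fixedWeight h b)))
                   ⊎ (h % 2 ≡ 0 × (FormB (fixedWeight h b) ⊎ FormC (fixedWeight h b)))
fixedWeight-form {h} {b} (3≤h , 4≤h) with height-cases h 3≤h | b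
... | inj₁ refl | false = inj₁ (refl , inj₁ (2 , ≤-refl , refl))
... | inj₁ refl | true = ⊥-elim (<-irrefl refl (4≤h refl))
... | inj₂ (inj₁ (t , 2≤t , refl)) | false =
  inj₂ (even-%2 t , inj₁ (t , 2≤t , formB⇐ t (trans (twice-fixedWeight-even t false 2≤t) (+-identityʳ _))))
... | inj₂ (inj₁ (t , 2≤t , refl)) | true =
  inj₂ (even-%2 t , inj₂ (t , 2≤t , formC⇐ t (twice-fixedWeight-even t true 2≤t)))
... | inj₂ (inj₂ (t , 2≤t , refl)) | false =
  inj₁ (odd-%2 t , inj₂ (t , 2≤t , trans (twice-fixedWeight-odd t false 2≤t) (+-identityʳ _)))
... | inj₂ (inj₂ (t , 2≤t , refl)) | true =
  inj₁ (odd-%2 t , inj₁ (suc t , m≤n⇒m≤1+n 2≤t , twice-fixedWeight-odd-true t 2≤t))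

FixedCode : ℕ → ℕ → Set
FixedCode n p = ∃[ h ] ∃[ b ] ValidHeight h b × h % 2 ≡ p × fixedWeight h b ≡ n

double-injective : ∀ {m n} → 2 * m ≡ 2 * n → m ≡ n
double-injective {m} {n} = *-cancelˡ-≡ m n 2

validHeight-even : ∀ {t} b → 2 ≤ t → ValidHeight (t + t) b
validHeight-even {t} _ 2≤t = ≤-trans (n≤1+n 3) 4≤t+t , λ _ → 4≤t+t
  where
  4≤t+t : 4 ≤ t + t
  4≤t+t = +-mono-≤ 2≤t 2≤t

validHeight-odd : ∀ {t} b → 2 ≤ t → ValidHeight (suc (t + t)) b
validHeight-odd b 2≤t with validHeight-even b 2≤t
... | 3≤ , 4≤ = m≤n⇒m≤1+n 3≤ , λ b≡ → m≤n⇒m≤1+n (4≤ b≡)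

odd-form⇒fixedCode : ∀ {n} → FormA n ⊎ FormD n → FixedCode n 1
odd-form⇒fixedCode (inj₁ (2 , _ , 2n≡)) = 3 , false , (s≤s (s≤s (s≤s z≤n)) , λ ()) , refl , double-injective (sym 2n≡)
odd-form⇒fixedCode (inj₁ (suc t@(suc (suc _)) , _ , 2n≡)) =
  suc (t + t) , true , validHeight-odd true 2≤t , odd-%2 t ,
  double-injective (trans (twice-fixedWeight-odd-true t 2≤t) (sym 2n≡))
  where
  2≤t : 2 ≤ t
  2≤t = s≤s (s≤s z≤n)
odd-form⇒fixedCode (inj₁ (1 , s≤s () , _))
odd-form⇒fixedCode (inj₂ (t , 2≤t , 2n≡)) =
  suc (t + t) , false , validHeight-odd false 2≤t , odd-%2 t ,
  double-injective (trans (trans (twice-fixedWeight-odd t false 2≤t) (+-identityʳ _)) (sym 2n≡))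

even-form⇒fixedCode : ∀ {n} → FormB n ⊎ FormC n → FixedCode n 0
even-form⇒fixedCode (inj₁ (t , 2≤t , 2n≡)) =
  t + t , false , validHeight-even false 2≤t , even-%2 t ,
  double-injective (+-cancelʳ-≡ (t + 1) _ _ (trans (trans (twice-fixedWeight-even t false 2≤t) (+-identityʳ _)) (sym (formB⇒ t 2n≡))))
even-form⇒fixedCode (inj₂ (t , 2≤t , 2n≡)) =
  t + t , true , validHeight-even true 2≤t , even-%2 t ,
  double-injective (+-cancelʳ-≡ (t + 1) _ _ (trans (twice-fixedWeight-even t true 2≤t) (sym (formC⇒ t 2n≡))))

moveCode : Code → Maybe Code
moveCode (code h E b) = Maybe.map (λ (h′ , E′) → code h′ E′ b) (move 3 h E)

partner : List ℕ → List ℕ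
partner q = fromMaybe q (Maybe.map decode (moveCode (encode q)))

IsFixed : List ℕ → Set
IsFixed q = moveCode (encode q) ≡ nothing

isFixed? : ∀ q → Dec (IsFixed q)
isFixed? q with moveCode (encode q)
... | nothing = yes refl
... | just _ = no λ ()

%2-suc : ∀ h → suc h % 2 ≡ 1 ∸ h % 2
%2-suc 0 = refl
%2-suc 1 = refl
%2-suc (suc (suc h)) = %2-suc h

%2-adjacent : ∀ {h h′} → Adjacent h h′ → h′ % 2 ≡ 1 ∸ h % 2
%2-adjacent {h} (inj₁ refl) = %2-suc h
%2-adjacent {h′ = h′} (inj₂ refl) = trans (sym (m∸[m∸n]≡n (≤-pred (m%n<n h′ 2)))) (cong (1 ∸_) (sym (%2-suc h′)))

moveCode-involutive : ∀ {x x′} → Valid x → moveCode x ≡ just x′ →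
                      Valid x′ × moveCode x′ ≡ just x × weight x′ ≡ weight x × Adjacent (Code.height x) (Code.height x′)
moveCode-involutive {code h E b} (_ , adm , _) eq with move 3 h E in moved
moveCode-involutive {code h E b} (_ , adm , _) refl | just (h′ , E′) =
  (3≤h′ , admissible , λ _ → ≤-trans (n≤1+n 4) 5≤h′) ,
  cong (Maybe.map _) moves-back ,
  weight′ ,
  adjacent
  where
  open Moved (move-moved adm moved)
  5≤h′ : 5 ≤ h′
  5≤h′ = ≤-pred room
  3≤h′ : 3 ≤ h′
  3≤h′ = ≤-trans (s≤s (s≤s (s≤s z≤n))) 5≤h′
  weight′ : 3 * h′ + sum (E′ ++ twoIf b) ≡ 3 * h + sum (E ++ twoIf b)
  weight′ = begin
    3 * h′ + sum (E′ ++ twoIf b)          ≡⟨ weight-split h′ E′ b ⟩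
    3 * h′ + sum E′ + sum (twoIf b)       ≡⟨ cong (_+ sum (twoIf b)) weight-≡ ⟨
    3 * h + sum E + sum (twoIf b)         ≡⟨ weight-split h E b ⟨
    3 * h + sum (E ++ twoIf b)            ∎
    where
    open ≡-Reasoning

partner-moved : ∀ {q x′} → moveCode (encode q) ≡ just x′ → partner q ≡ decode x′
partner-moved {q} = cong (λ m → fromMaybe q (Maybe.map decode m))

partner-involutive : ∀ {n q} → Counted n q → ¬ IsFixed q →
                     Counted n (partner q) × ¬ IsFixed (partner q) × partner (partner q) ≡ q ×
                     length (partner q) % 2 ≡ 1 ∸ length q % 2
partner-involutive {n} {q} c ¬fixed with moveCode (encode q) in moved
... | nothing = ⊥-elim (¬fixed refl)
... | just x′ with moveCode-involutive (encode-valid c) moved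
... | valid′ , back , weight≡ , adjacent =
  counted′ ,
  (λ fixed′ → just≢nothing (trans (sym back) (trans (cong moveCode (sym (encode-decode valid′))) fixed′))) ,
  trans (partner-moved {decode x′} (trans (cong moveCode (encode-decode valid′)) back)) (decode-encode c) ,
  trans (cong (_% 2) (length-decode valid′)) (%2-adjacent adjacent)
  where
  counted′ : Counted n (decode x′)
  counted′ = subst (λ m → Counted m (decode x′)) (trans weight≡ (weight-encode c)) (decode-counted valid′)

fixed-staircase : ∀ {x} → Valid x → moveCode x ≡ nothing → Code.steps x ≡ staircase (Code.height x)
fixed-staircase {code h E b} (3≤h , adm , _) eq with move 3 h E in unmoved
... | nothing = Fixed-unique (move≡nothing⇒Fixed (s≤s z≤n) adm unmoved) (staircase-fixed h 3≤h)

fixed-shape : ∀ {n q} → Counted n q → IsFixed q →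
              ∃[ b ] ValidHeight (length q) b × fixedWeight (length q) b ≡ n × q ≡ decode (code (length q) (staircase (length q)) b)
fixed-shape {n} {q} c fixed with encode-valid c
... | valid@(3≤h , _ , 4≤h) =
  Code.two (encode q) , (3≤h , 4≤h) ,
  trans (cong (λ E → weight (code (length q) E (Code.two (encode q)))) (sym E≡)) (weight-encode c) ,
  trans (sym (decode-encode c)) (cong (λ E → decode (code (length q) E (Code.two (encode q)))) E≡)
  where
  E≡ : Code.steps (encode q) ≡ staircase (length q)
  E≡ = fixed-staircase valid fixed

staircase-valid : ∀ {h b} → ValidHeight h b → Valid (code h (staircase h) b)
staircase-valid {h} (3≤h , 4≤h) = 3≤h , Fixed⇒admissible (staircase-fixed h 3≤h) , 4≤h

staircase-isFixed : ∀ {h b} → ValidHeight h b → IsFixed (decode (code h (staircase h) b))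
staircase-isFixed {h} valid@(3≤h , _) =
  trans (cong moveCode (encode-decode (staircase-valid valid)))
        (cong (Maybe.map _) (Fixed⇒move≡nothing (staircase-fixed h 3≤h)))

parts≤sum : ∀ q → All (_≤ sum q) q
parts≤sum [] = []
parts≤sum (x ∷ q) = m≤m+n x (sum q) ∷ All.map (λ y≤ → ≤-trans y≤ (m≤n+m (sum q) x)) (parts≤sum q)

length≤sum : ∀ {q} → All (1 ≤_) q → length q ≤ sum q
length≤sum [] = z≤n
length≤sum (1≤x ∷ 1≤q) = +-mono-≤ 1≤x (length≤sum 1≤q)

counted∈candidates : ∀ {n q} → Counted n q → q ∈ candidates n
counted∈candidates {n} {q} c@(sum≡ , _) =
  ∈-candidates n q (All.zipWith (λ (3≤x , x≤) → ≤-trans (s≤s z≤n) 3≤x , subst (_ ≤_) sum≡ x≤) (3≤q , parts≤sum q))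
                   (subst (length q ≤_) sum≡ (length≤sum (All.map (≤-trans (s≤s z≤n)) 3≤q)))
  where
  3≤q : All (3 ≤_) q
  3≤q = ramp-≥3 (counted-ramp c)

CountedWithParity : ℕ → ℕ → List ℕ → Set
CountedWithParity n p q = Counted n q × length q % 2 ≡ p

countedWithParity? : ∀ n p q → Dec (CountedWithParity n p q)
countedWithParity? n p q = counted? n q ×-dec (length q % 2 ≟ p)

moving? : ∀ n p q → Dec (CountedWithParity n p q × ¬ IsFixed q)
moving? n p q = countedWithParity? n p q ×-dec ¬? (isFixed? q)

fixed? : ∀ n p q → Dec (CountedWithParity n p q × IsFixed q)
fixed? n p q = countedWithParity? n p q ×-dec isFixed? q

moving : ℕ → ℕ → ℕ
moving n p = length (filter (moving? n p) (candidates n))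

fixedCount : ℕ → ℕ → ℕ
fixedCount n p = length (filter (fixed? n p) (candidates n))

count-split : ∀ n p → length (filter (countedWithParity? n p) (candidates n)) ≡ moving n p + fixedCount n p
count-split n p = length-filter-split (countedWithParity? n p) isFixed? (candidates n)

moving-balanced : ∀ n → moving n 0 ≡ moving n 1
moving-balanced n = length-filter-≡ (moving? n 0) (moving? n 1) (candidates-unique n) partner (exchange 0) (exchange 1)
  where
  exchange : ∀ p {q} → q ∈ candidates n → CountedWithParity n p q × ¬ IsFixed q →
             partner q ∈ candidates n × (CountedWithParity n (1 ∸ p) (partner q) × ¬ IsFixed (partner q)) × partner (partner q) ≡ q
  exchange p _ ((c , refl) , ¬fixed) with partner-involutive c ¬fixed
  ... | c′ , ¬fixed′ , involutive , parity = counted∈candidates c′ , ((c′ , parity) , ¬fixed′) , involutive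

fixedCount-none : ∀ n p → (∀ {q} → Counted n q → IsFixed q → length q % 2 ≢ p) → fixedCount n p ≡ 0
fixedCount-none n p none = length-filter-≡0 (fixed? n p) (candidates n) (λ _ ((c , parity) , fixed) → none c fixed parity)

isFixed-unique : ∀ {n q} h b → fixedWeight h b ≡ n → Counted n q → IsFixed q → q ≡ decode (code h (staircase h) b)
isFixed-unique {q = q} h b weight≡ c fixed with fixed-shape c fixed
... | b′ , _ , weight′≡ , q≡ with fixedWeight-injective {length q} {h} {b′} {b} (trans weight′≡ (sym weight≡))
... | refl , refl = q≡

fixedCount-one : ∀ n p → FixedCode n p → fixedCount n p ≡ 1
fixedCount-one n p (h , b , valid , parity , weight≡) =
  length-filter-≡1 (fixed? n p) (candidates-unique n) (counted∈candidates counted) ((counted , parity′) , staircase-isFixed valid)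
    (λ _ ((c , _) , fixed) → isFixed-unique h b weight≡ c fixed)
  where
  valid′ : Valid (code h (staircase h) b)
  valid′ = staircase-valid valid
  counted : Counted n (decode (code h (staircase h) b))
  counted = subst (λ m → Counted m _) weight≡ (decode-counted valid′)
  parity′ : length (decode (code h (staircase h) b)) % 2 ≡ p
  parity′ = trans (cong (_% 2) (length-decode valid′)) parity

fixedCount-other : ∀ n p p′ → FixedCode n p → p ≢ p′ → fixedCount n p′ ≡ 0
fixedCount-other n p p′ (h , b , valid , parity , weight≡) p≢p′ =
  fixedCount-none n p′ λ c fixed parity′ →
    p≢p′ (trans (sym (trans (cong (_% 2) (length-decode (staircase-valid valid))) parity))
                (trans (cong (λ q → length q % 2) (sym (isFixed-unique h b weight≡ c fixed))) parity′))

no-form⇒no-fixed : ∀ {n q} → ¬ FormA n × ¬ FormB n × ¬ FormC n × ¬ FormD n → Counted n q → ¬ IsFixed q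
no-form⇒no-fixed (¬A , ¬B , ¬C , ¬D) c fixed with fixed-shape c fixed
... | b , valid , refl , _ with fixedWeight-form valid
... | inj₁ (_ , inj₁ A) = ¬A A
... | inj₁ (_ , inj₂ D) = ¬D D
... | inj₂ (_ , inj₁ B) = ¬B B
... | inj₂ (_ , inj₂ C) = ¬C C

corollary4p10 : (n : ℕ) → 6 ≤ n →
    ((¬ FormA n × ¬ FormB n × ¬ FormC n × ¬ FormD n) → e'' n ≡ o'' n)
    × ((FormA n ⊎ FormD n) → suc (e'' n) ≡ o'' n)
    × ((FormB n ⊎ FormC n) → e'' n ≡ suc (o'' n))
corollary4p10 n _ = no-form , odd-form , even-form
  where
  none : (¬ FormA n × ¬ FormB n × ¬ FormC n × ¬ FormD n) → ∀ p → fixedCount n p ≡ 0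
  none ¬forms p = fixedCount-none n p (λ c fixed _ → no-form⇒no-fixed ¬forms c fixed)
  e≡ : e'' n ≡ moving n 1 + fixedCount n 0
  e≡ = trans (count-split n 0) (cong (_+ fixedCount n 0) (moving-balanced n))
  o≡ : o'' n ≡ moving n 1 + fixedCount n 1
  o≡ = count-split n 1
  no-form : (¬ FormA n × ¬ FormB n × ¬ FormC n × ¬ FormD n) → e'' n ≡ o'' n
  no-form ¬forms rewrite e≡ | o≡ | none ¬forms 0 | none ¬forms 1 = refl
  odd-form : (FormA n ⊎ FormD n) → suc (e'' n) ≡ o'' n
  odd-form form with fc ← odd-form⇒fixedCode form
    rewrite e≡ | o≡ | fixedCount-other n 1 0 fc (λ ()) | fixedCount-one n 1 fc = sym (+-suc (moving n 1) 0)
  even-form : (FormB n ⊎ FormC n) → e'' n ≡ suc (o'' n)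
  even-form form with fc ← even-form⇒fixedCode form
    rewrite e≡ | o≡ | fixedCount-one n 0 fc | fixedCount-other n 0 1 fc (λ ()) = +-suc (moving n 1) 0
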